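{- Let $\alpha$ and $\beta$ be compositions with $\beta\subseteq\alpha$. Then \[\mathfrak S^*_{\alpha/\beta}=\sum_T x^T,\] where the sum is over all skew immaculate tableaux $T$ of shape $\alpha/\beta$, and \[\mathcal R\mathfrak S^*_{\alpha/\beta}=\sum_T x^T,\] where the sum is over all skew row-strict immaculate tableaux $T$ of shape $\alpha/\beta$.
   Context: Compositions have diagrams with $\alpha_i$ left-justified boxes in row $i$ (row 1 at bottom). $\beta\subseteq\alpha$ means $\ell(\beta)\le\ell(\alpha)$ and $\beta_j\le\alpha_j$ for $j\le\ell(\beta)$; $\alpha/\beta$ is the set of boxes of $\alpha$ not in $\beta$. A skew immaculate tableau of shape $\alpha/\beta$ is a filling of $\alpha/\beta$ by positive integers such that the entries in the first column of $\alpha$ (if any lie in $\alpha/\beta$) strictly increase bottom to top and rows weakly increase left to right; a skew row-strict immaculate tableau is a filling such that those first-column entries weakly increase bottom to top and rows strictly increase left to right. $x^T=\prod_ix_i^{\#\{i\text{'s in }T\}}$. $\mathrm{QSym}$ and $\mathrm{NSym}$ are dual via the pairing with $\langle\mathbf h_\alpha,M_\beta\rangle=\delta_{\alpha\beta}$ ($M_\beta$ monomial quasisymmetric functions, $\mathbf h_\alpha$ noncommutative complete homogeneous functions). $\mathfrak S^*_\alpha$ is the dual immaculate function (generating function of fillings of $\alpha$ with leftmost column strictly increasing upward and rows weakly increasing) and $\mathcal R\mathfrak S^*_\alpha$ the row-strict dual immaculate function (leftmost column weakly increasing upward, rows strictly increasing); $\mathfrak S_\alpha$, $\mathcal R\mathfrak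 S_\alpha$ are the dual bases of $\mathrm{NSym}$. Define $\mathfrak S^*_{\alpha/\beta}=\sum_\gamma\langle\mathfrak S_\beta\mathbf h_\gamma,\mathfrak S^*_\alpha\rangle M_\gamma$ and $\mathcal R\mathfrak S^*_{\alpha/\beta}=\sum_\gamma\langle\mathcal R\mathfrak S_\beta\mathbf h_\gamma,\mathcal R\mathfrak S^*_\alpha\rangle M_\gamma$, the sums over compositions $\gamma$ of $|\alpha|-|\beta|$. -}

module Defs where

open import Data.Nat as ℕ using (ℕ; zero; suc; _∸_; _≤_; _<_; _≤?_; _<?_; _≟_)
open import Data.Integer as ℤ using (ℤ; +_; 0ℤ; 1ℤ)
open import Data.List using (List; []; _∷_; [_]; length; map; concat; concatMap; _++_; filter; upTo; foldr)
open import Data.List.Properties using (≡-dec)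
open import Data.Nat.ListAction using (sum)
open import Data.List.Relation.Unary.All using (All; all?)
open import Data.List.Relation.Unary.Linked using (Linked; linked?)
open import Data.Product using (_×_; _,_; proj₂)
open import Relation.Nullary using (Dec; does)
open import Relation.Nullary.Decidable using (_×-dec_)
open import Relation.Binary.PropositionalEquality using (_≡_)
open import Data.Bool using (if_then_else_)
open import Function using (_∘_)

-- Compositions (lists of positive naturals; first entry = row 1 = bottom)

IsComp : List ℕ → Set
IsComp α = All (0 <_) α

size : List ℕ → ℕ
size = sum

data _⊆c_ : List ℕ → List ℕ → Set where
  []⊆  : ∀ {α} → [] ⊆c α
  _∷⊆_ : ∀ {a b α β} → b ≤ a → β ⊆c α → (b ∷ β) ⊆c (a ∷ α)

comps : ℕ → List (List ℕ)
comps zero    = [ [] ]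
comps (suc n) = concatMap step (comps n)
  where
  step : List ℕ → List (List ℕ)
  step []      = [ 1 ∷ [] ]
  step (a ∷ c) = (1 ∷ a ∷ c) ∷ (suc a ∷ c) ∷ []

kron : List ℕ → List ℕ → ℤ
kron α β = if does (≡-dec _≟_ α β) then 1ℤ else 0ℤ

-- the rows of α/β, bottom to top, as pairs (β_i , α_i), with β_i = 0 for i > ℓ(β);
-- row i consists of the boxes in columns β_i + 1 , … , α_i
skewRows : List ℕ → List ℕ → List (ℕ × ℕ)
skewRows []      _       = []
skewRows (a ∷ α) []      = (0 , a) ∷ skewRows α []
skewRows (a ∷ α) (b ∷ β) = (b , a) ∷ skewRows α β

rowLengths : List ℕ → List ℕ → List ℕ
rowLengths α β = map (λ p → Data.Product.proj₂ p ∸ Data.Product.proj₁ p) (skewRows α β)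

-- a filling: list of rows (bottom to top), each row read left to right
Filling : Set
Filling = List (List ℕ)

words : ℕ → ℕ → List (List ℕ)
words m zero    = [ [] ]
words m (suc n) = concatMap (λ x → map (x ∷_) (words m n)) (map suc (upTo m))

fillings : ℕ → List ℕ → List Filling
fillings m []       = [ [] ]
fillings m (l ∷ ls) = concatMap (λ w → map (w ∷_) (fillings m ls)) (words m l)

-- entries of the filling lying in the first column of α (rows with β_i = 0),
-- bottom to top
firstCol : List (ℕ × ℕ) → Filling → List ℕ
firstCol ((zero , _) ∷ rs) ((x ∷ _) ∷ T) = x ∷ firstCol rs T
firstCol (_ ∷ rs)          (_ ∷ T)       = firstCol rs T
firstCol _                 _             = []

IsSkewImmaculate : List ℕ → List ℕ → Filling → Set
IsSkewImmaculate α β T = All (Linked _≤_) T × Linked _<_ (firstCol (skewRows α β) T)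

IsSkewRowStrict : List ℕ → List ℕ → Filling → Set
IsSkewRowStrict α β T = All (Linked _<_) T × Linked _≤_ (firstCol (skewRows α β) T)

isSkewImmaculate? : ∀ α β T → Dec (IsSkewImmaculate α β T)
isSkewImmaculate? α β T = all? (linked? _≤?_) T ×-dec linked? _<?_ (firstCol (skewRows α β) T)

isSkewRowStrict? : ∀ α β T → Dec (IsSkewRowStrict α β T)
isSkewRowStrict? α β T = all? (linked? _<?_) T ×-dec linked? _≤?_ (firstCol (skewRows α β) T)

count : ℕ → List ℕ → ℕ
count i xs = length (filter (i ≟_) xs)

-- exponent vector (#1's, #2's, …, #m's) of x^T
content : ℕ → Filling → List ℕ
content m T = map (λ i → count i (concat T)) (map suc (upTo m))

-- Formal power series in x_1, x_2, … : coefficient of the monomial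
-- x^c = x_1^{c_1} ⋯ x_k^{c_k}, for c an exponent vector (weak composition).

Series : Set
Series = List ℕ → ℤ

-- Σ_T x^T over skew immaculate tableaux T of shape α/β: the coefficient of x^c
-- is the number of such T with x^T = x^c (entries then lie in {1,…,ℓ(c)}).
skewImmSeries : List ℕ → List ℕ → Series
skewImmSeries α β c =
  + length (filter (λ T → isSkewImmaculate? α β T ×-dec ≡-dec _≟_ (content (length c) T) c)
                   (fillings (length c) (rowLengths α β)))

skewRowStrictSeries : List ℕ → List ℕ → Series
skewRowStrictSeries α β c =
  + length (filter (λ T → isSkewRowStrict? α β T ×-dec ≡-dec _≟_ (content (length c) T) c)
                   (fillings (length c) (rowLengths α β)))

dualImm : List ℕ → Series
dualImm α = skewImmSeries α []

rowStrictDualImm : List ℕ → Series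
rowStrictDualImm α = skewRowStrictSeries α []

flat : List ℕ → List ℕ
flat []          = []
flat (zero ∷ c)  = flat c
flat (suc a ∷ c) = suc a ∷ flat c

M : List ℕ → Series
M γ c = kron γ (flat c)

-- NSym: finite ℤ-linear combinations Σ k · h_δ of the basis h_δ (δ compositions)

NSym : Set
NSym = List (ℤ × List ℕ)

-- right multiplication by h_γ  (h_δ h_γ = h_{δ·γ})
_·h_ : NSym → List ℕ → NSym
x ·h γ = map (λ p → Data.Product.proj₁ p , Data.Product.proj₂ p ++ γ) x

-- the pairing ⟨ h_δ , F ⟩ = coefficient of M_δ in F = coefficient of
-- x_1^{δ_1} ⋯ x_k^{δ_k} in F (F quasisymmetric), extended linearly
⟪_,_⟫ : NSym → Series → ℤ
⟪ x , F ⟫ = foldr (λ p acc → Data.Product.proj₁ p ℤ.* F (Data.Product.proj₂ p) ℤ.+ acc) 0ℤ x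

IsDualBasis : (List ℕ → NSym) → (List ℕ → Series) → Set
IsDualBasis S F =
  (∀ β → All (IsComp ∘ proj₂) (S β)) ×
  (∀ α β → IsComp α → IsComp β → ⟪ S β , F α ⟫ ≡ kron α β)

sumℤ : List ℤ → ℤ
sumℤ = foldr ℤ._+_ 0ℤ

skewDual : (List ℕ → NSym) → (List ℕ → Series) → List ℕ → List ℕ → Series
skewDual S F α β c =
  sumℤ (map (λ γ → ⟪ S β ·h γ , F α ⟫ ℤ.* M γ c) (comps (size α ∸ size β)))

-- Both identities are one argument, run with the relations imposed along rows and down the first
-- column: (≤, <) for immaculate and (<, ≤) for row-strict tableaux.  Let N(α/β; c) count such tableaux of
-- shape α/β and content c.  Cutting a tableau at the value ℓ(δ), into the entries ≤ ℓ(δ) and the others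
-- lowered by ℓ(δ), is a bijection giving
--   N(α/β; δγ) = Σ_{β ⊆ σ ⊆ α} N(σ/β; δ) N(α/σ; γ).
-- With δ = [0] only σ = β survives, so zero exponents can be dropped and N(α/β; –) is quasisymmetric.
-- With β = ∅ it expands 𝔖*_α(δγ) as Σ_σ 𝔖*_σ(δ) N(α/σ; γ); pairing with S_β and using duality gives
-- ⟨S_β h_γ, 𝔖*_α⟩ = N(α/β; γ), and summing against the M_γ returns the tableau series.

module Submission where

open import Defs
open import Data.Nat using (ℕ; zero; suc; _+_; _*_; _∸_; _≤_; _<_; _≤?_; _<?_; _≟_; z≤n; s≤s)
import Data.Nat.Properties as ℕₚ
import Data.Integer.Properties as ℤₚ
open import Algebra.Properties.CommutativeSemigroup ℕₚ.+-commutativeSemigroup using (interchange)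
open import Algebra.Properties.CommutativeSemigroup ℤₚ.+-commutativeSemigroup using () renaming (interchange to interchangeℤ)
open import Data.Nat.ListAction using (sum)
open import Data.Integer as ℤ using (ℤ; 0ℤ; 1ℤ)
open import Data.List
  using (List; []; _∷_; [_]; length; map; concat; concatMap; _++_; filter; upTo; applyUpTo;
         cartesianProductWith; cartesianProduct)
import Data.List.Properties as Listₚ
open import Data.List.Properties using (≡-dec)
open import Data.List.Membership.Propositional using (_∈_; _∉_; find; lose)
open import Data.List.Membership.Propositional.Properties
  using (∈-concatMap⁺; ∈-concatMap⁻; ∈-map⁺; ∈-map⁻; ∈-filter⁺; ∈-filter⁻;
         ∈-cartesianProductWith⁺; ∈-cartesianProductWith⁻; ∈-cartesianProduct⁺; ∈-cartesianProduct⁻; ∈-upTo⁺; ∈-upTo⁻)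
open import Data.List.Membership.Propositional.Properties.WithK using (unique∧set⇒bag)
open import Data.List.Relation.Binary.BagAndSetEquality using (∼bag⇒↭; _∼[_]_; set)
open import Data.List.Relation.Binary.Permutation.Propositional.Properties using (↭-length)
open import Data.List.Relation.Binary.Pointwise using (Pointwise; []; _∷_; Pointwise-length)
open import Data.List.Relation.Unary.All as All using (All; []; _∷_)
import Data.List.Relation.Unary.All.Properties as Allₚ
import Data.List.Relation.Unary.Linked.Properties as LinkedP
open import Data.List.Relation.Unary.Any using (here; there)
open import Data.List.Relation.Unary.Linked as Linked using (Linked; []; [-]; _∷_)
open import Data.List.Relation.Unary.AllPairs using ([]; _∷_)
open import Data.List.Relation.Unary.Unique.Propositional using (Unique)
import Data.List.Relation.Unary.Unique.Propositional.Properties as Uniqueₚ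
open import Data.Product as Product using (_×_; _,_; proj₁; proj₂)
open import Data.Bool using (true; false; if_then_else_)
open import Data.Empty using (⊥-elim)
open import Function using (_∘_; mk⇔)
open import Relation.Nullary using (Dec; yes; no; ¬_; does)
open import Relation.Nullary.Decidable using (_×-dec_)
open import Relation.Unary using (Pred; Decidable)
open import Relation.Binary.PropositionalEquality using (_≡_; _≢_; refl; sym; trans; cong; cong₂; subst; subst₂; module ≡-Reasoning)
open import Level using (0ℓ)

private variable
  A B C : Set

concatMap-map≡cartesianProductWith : (f : A → B → C) (xs : List A) (ys : List B) →
  concatMap (λ x → map (f x) ys) xs ≡ cartesianProductWith f xs ys
concatMap-map≡cartesianProductWith f []       ys = refl
concatMap-map≡cartesianProductWith f (x ∷ xs) ys = cong (map (f x) ys ++_) (concatMap-map≡cartesianProductWith f xs ys)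

unique-concatMap : (f : A → List B) (tag : B → A) {xs : List A} → Unique xs →
  (∀ {x} → x ∈ xs → Unique (f x)) → (∀ {x z} → x ∈ xs → z ∈ f x → tag z ≡ x) →
  Unique (concatMap f xs)
unique-concatMap f tag {[]} _ _ _ = []
unique-concatMap f tag {x ∷ xs} (x∉ ∷ u) uf tg =
  Uniqueₚ.++⁺ (uf (here refl)) (unique-concatMap f tag u (uf ∘ there) (tg ∘ there)) disjoint
  where
  disjoint : ∀ {z} → ¬ (z ∈ f x × z ∈ concatMap f xs)
  disjoint (z∈fx , z∈rest) with find (∈-concatMap⁻ f z∈rest)
  ... | y , y∈ , z∈fy = All.lookup x∉ y∈ (trans (sym (tg (here refl) z∈fx)) (tg (there y∈) z∈fy))

length-filter-bijection : {P : Pred A 0ℓ} {Q : Pred B 0ℓ} (P? : Decidable P) (Q? : Decidable Q)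
  {xs : List A} {ys : List B} → Unique xs → Unique ys → (f : A → B) (g : B → A) →
  (∀ {x} → x ∈ xs → P x → (f x ∈ ys × Q (f x)) × g (f x) ≡ x) →
  (∀ {y} → y ∈ ys → Q y → (g y ∈ xs × P (g y)) × f (g y) ≡ y) →
  length (filter P? xs) ≡ length (filter Q? ys)
length-filter-bijection P? Q? {xs} {ys} !xs !ys f g fwd bwd =
  trans (sym (Listₚ.length-map f (filter P? xs))) (↭-length (∼bag⇒↭ (unique∧set⇒bag !image !target sameSet)))
  where
  !image : Unique (map f (filter P? xs))
  !image = Uniqueₚ.map⁻ (subst Unique (sym g∘f≡id) (Uniqueₚ.filter⁺ P? !xs))
    where
    g∘f≡id : map g (map f (filter P? xs)) ≡ filter P? xs
    g∘f≡id = trans (sym (Listₚ.map-∘ (filter P? xs)))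
      (trans (Listₚ.map-cong-local (All.tabulate λ x∈ → let x∈xs , px = ∈-filter⁻ P? x∈ in proj₂ (fwd x∈xs px)))
             (Listₚ.map-id (filter P? xs)))
  !target : Unique (filter Q? ys)
  !target = Uniqueₚ.filter⁺ Q? !ys
  sameSet : map f (filter P? xs) ∼[ set ] filter Q? ys
  sameSet = mk⇔ to from
    where
    to : ∀ {v} → v ∈ map f (filter P? xs) → v ∈ filter Q? ys
    to v∈ with ∈-map⁻ f v∈
    ... | x , x∈ , refl = let x∈xs , px = ∈-filter⁻ P? x∈ ; (fx∈ , qfx) , _ = fwd x∈xs px in ∈-filter⁺ Q? fx∈ qfx
    from : ∀ {v} → v ∈ filter Q? ys → v ∈ map f (filter P? xs)
    from v∈ = let v∈ys , qv = ∈-filter⁻ Q? v∈ ; (gv∈ , pgv) , fgv≡v = bwd v∈ys qv in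
      subst (_∈ map f (filter P? xs)) fgv≡v (∈-map⁺ f (∈-filter⁺ P? gv∈ pgv))

++-injective : ∀ (xs : List A) {ys zs ws} → length xs ≡ length zs → xs ++ ys ≡ zs ++ ws → xs ≡ zs × ys ≡ ws
++-injective []       {zs = []}     _   eq = refl , eq
++-injective (x ∷ xs) {zs = z ∷ zs} len eq with Listₚ.∷-injective eq
... | refl , eq′ = Product.map₁ (cong (x ∷_)) (++-injective xs (ℕₚ.suc-injective len) eq′)

∑ : (A → ℕ) → List A → ℕ
∑ f []       = 0
∑ f (x ∷ xs) = f x + ∑ f xs

sum-map : (f : A → ℕ) (xs : List A) → sum (map f xs) ≡ ∑ f xs
sum-map f []       = refl
sum-map f (x ∷ xs) = cong (f x +_) (sum-map f xs)

∑-++ : (f : A → ℕ) (xs ys : List A) → ∑ f (xs ++ ys) ≡ ∑ f xs + ∑ f ys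
∑-++ f []       ys = refl
∑-++ f (x ∷ xs) ys = trans (cong (f x +_) (∑-++ f xs ys)) (sym (ℕₚ.+-assoc (f x) (∑ f xs) (∑ f ys)))

∑-concatMap : (f : B → ℕ) (g : A → List B) (xs : List A) → ∑ f (concatMap g xs) ≡ ∑ (∑ f ∘ g) xs
∑-concatMap f g []       = refl
∑-concatMap f g (x ∷ xs) = trans (∑-++ f (g x) (concatMap g xs)) (cong (∑ f (g x) +_) (∑-concatMap f g xs))

∑-map : (f : B → ℕ) (g : A → B) (xs : List A) → ∑ f (map g xs) ≡ ∑ (f ∘ g) xs
∑-map f g []       = refl
∑-map f g (x ∷ xs) = cong (f (g x) +_) (∑-map f g xs)

∑-cong-local : {f g : A → ℕ} (xs : List A) → All (λ x → f x ≡ g x) xs → ∑ f xs ≡ ∑ g xs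
∑-cong-local []       []         = refl
∑-cong-local (x ∷ xs) (eq ∷ eqs) = cong₂ _+_ eq (∑-cong-local xs eqs)

∑-+ : (f g : A → ℕ) (xs : List A) → ∑ (λ x → f x + g x) xs ≡ ∑ f xs + ∑ g xs
∑-+ f g []       = refl
∑-+ f g (x ∷ xs) = trans (cong (f x + g x +_) (∑-+ f g xs)) (interchange (f x) (g x) (∑ f xs) (∑ g xs))

∑-*ˡ : (k : ℕ) (f : A → ℕ) (xs : List A) → ∑ (λ x → k * f x) xs ≡ k * ∑ f xs
∑-*ˡ k f []       = sym (ℕₚ.*-zeroʳ k)
∑-*ˡ k f (x ∷ xs) = trans (cong (k * f x +_) (∑-*ˡ k f xs)) (sym (ℕₚ.*-distribˡ-+ k (f x) (∑ f xs)))

∑-cartesianProduct : (f : A → ℕ) (g : B → ℕ) (xs : List A) (ys : List B) →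
  ∑ (λ p → f (proj₁ p) * g (proj₂ p)) (cartesianProduct xs ys) ≡ ∑ f xs * ∑ g ys
∑-cartesianProduct f g []       ys = refl
∑-cartesianProduct {A} {B} f g (x ∷ xs) ys = begin
  ∑ h (map (x ,_) ys ++ cartesianProduct xs ys)        ≡⟨ ∑-++ h (map (x ,_) ys) (cartesianProduct xs ys) ⟩
  ∑ h (map (x ,_) ys) + ∑ h (cartesianProduct xs ys)   ≡⟨ cong₂ _+_ (trans (∑-map h (x ,_) ys) (∑-*ˡ (f x) g ys))
                                                                   (∑-cartesianProduct f g xs ys) ⟩
  f x * ∑ g ys + ∑ f xs * ∑ g ys                      ≡⟨ ℕₚ.*-distribʳ-+ (∑ g ys) (f x) (∑ f xs) ⟨
  ∑ f (x ∷ xs) * ∑ g ys                               ∎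
  where
  open ≡-Reasoning
  h : A × B → ℕ
  h (a , b) = f a * g b

∑-delta : (xs : List A) {y : A} (w h : A → ℕ) → Unique xs → y ∈ xs →
  (∀ {x} → x ∈ xs → x ≢ y → w x ≡ 0) → w y ≡ 1 → ∑ (λ x → w x * h x) xs ≡ h y
∑-delta (x ∷ xs) w h (x∉ ∷ !xs) (here refl) w≡0 w≡1 =
  trans (cong₂ _+_ (trans (cong (_* h x) w≡1) (ℕₚ.+-identityʳ (h x)))
                   (trans (∑-cong-local xs (All.tabulate λ x′∈ → cong (_* h _) (w≡0 (there x′∈) (λ e → All.lookup x∉ x′∈ (sym e)))))
                          (∑-*ˡ 0 h xs)))
        (ℕₚ.+-identityʳ (h x))
∑-delta (x ∷ xs) w h (x∉ ∷ !xs) (there y∈) w≡0 w≡1 =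
  trans (cong (_+ ∑ (λ x′ → w x′ * h x′) xs) (cong (_* h x) (w≡0 (here refl) (λ e → All.lookup x∉ y∈ e))))
        (∑-delta xs w h !xs y∈ (w≡0 ∘ there) w≡1)

𝟙 : {P : Set} → Dec P → ℕ
𝟙 d = if does d then 1 else 0

length-filter≡∑𝟙 : {P : Pred A 0ℓ} (P? : Decidable P) (xs : List A) → length (filter P? xs) ≡ ∑ (𝟙 ∘ P?) xs
length-filter≡∑𝟙 P? []       = refl
length-filter≡∑𝟙 P? (x ∷ xs) with does (P? x)
... | true  = cong suc (length-filter≡∑𝟙 P? xs)
... | false = length-filter≡∑𝟙 P? xs

𝟙-×-dec : {P Q : Set} (p : Dec P) (q : Dec Q) → 𝟙 (p ×-dec q) ≡ 𝟙 p * 𝟙 q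
𝟙-×-dec (yes _) (yes _) = refl
𝟙-×-dec (yes _) (no _)  = refl
𝟙-×-dec (no _)  _       = refl

Letter : ℕ → ℕ → Set
Letter m x = 0 < x × x ≤ m

letters : ℕ → List ℕ
letters m = map suc (upTo m)

∈-letters⁻ : ∀ {m x} → x ∈ letters m → Letter m x
∈-letters⁻ x∈ with ∈-map⁻ suc x∈
... | i , i∈ , refl = s≤s z≤n , ∈-upTo⁻ i∈

∈-letters⁺ : ∀ {m x} → Letter m x → x ∈ letters m
∈-letters⁺ {x = suc i} (_ , i<m) = ∈-map⁺ suc (∈-upTo⁺ i<m)

letters-unique : ∀ m → Unique (letters m)
letters-unique m = Uniqueₚ.map⁺ ℕₚ.suc-injective (Uniqueₚ.upTo⁺ m)

RowFill : ℕ → List ℕ → ℕ → Set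
RowFill m w l = length w ≡ l × All (Letter m) w

Fill : ℕ → Filling → List ℕ → Set
Fill m = Pointwise (RowFill m)

words-suc : ∀ m n → words m (suc n) ≡ cartesianProductWith _∷_ (letters m) (words m n)
words-suc m n = concatMap-map≡cartesianProductWith _∷_ (letters m) (words m n)

fillings-∷ : ∀ m l ls → fillings m (l ∷ ls) ≡ cartesianProductWith _∷_ (words m l) (fillings m ls)
fillings-∷ m l ls = concatMap-map≡cartesianProductWith _∷_ (words m l) (fillings m ls)

∈-words⁻ : ∀ {m} n {w} → w ∈ words m n → RowFill m w n
∈-words⁻ zero (here refl) = refl , []
∈-words⁻ {m} (suc n) w∈
  with _ , _ , x∈ , v∈ , refl ← ∈-cartesianProductWith⁻ _∷_ (letters m) (words m n) (subst (_ ∈_) (words-suc m n) w∈)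
  = let len , ok = ∈-words⁻ n v∈ in cong suc len , ∈-letters⁻ x∈ ∷ ok

∈-words⁺ : ∀ {m n w} → RowFill m w n → w ∈ words m n
∈-words⁺ {w = []}    (refl , [])        = here refl
∈-words⁺ {m} {w = x ∷ w} (refl , ok ∷ oks) =
  subst (_ ∈_) (sym (words-suc m (length w))) (∈-cartesianProductWith⁺ _∷_ (∈-letters⁺ ok) (∈-words⁺ (refl , oks)))

words-unique : ∀ m n → Unique (words m n)
words-unique m zero    = [] ∷ []
words-unique m (suc n) =
  subst Unique (sym (words-suc m n)) (Uniqueₚ.cartesianProductWith⁺ _∷_ Listₚ.∷-injective (letters-unique m) (words-unique m n))

∈-fillings⁻ : ∀ {m} ls {T} → T ∈ fillings m ls → Fill m T ls
∈-fillings⁻ [] (here refl) = []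
∈-fillings⁻ {m} (l ∷ ls) T∈
  with _ , _ , w∈ , T′∈ , refl ← ∈-cartesianProductWith⁻ _∷_ (words m l) (fillings m ls) (subst (_ ∈_) (fillings-∷ m l ls) T∈)
  = ∈-words⁻ l w∈ ∷ ∈-fillings⁻ ls T′∈

∈-fillings⁺ : ∀ {m ls T} → Fill m T ls → T ∈ fillings m ls
∈-fillings⁺ []                  = here refl
∈-fillings⁺ {m} {l ∷ ls} (row ∷ rows) =
  subst (_ ∈_) (sym (fillings-∷ m l ls)) (∈-cartesianProductWith⁺ _∷_ (∈-words⁺ row) (∈-fillings⁺ rows))

fillings-unique : ∀ m ls → Unique (fillings m ls)
fillings-unique m []       = [] ∷ []
fillings-unique m (l ∷ ls) =
  subst Unique (sym (fillings-∷ m l ls)) (Uniqueₚ.cartesianProductWith⁺ _∷_ Listₚ.∷-injective (words-unique m l) (fillings-unique m ls))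

Fill⇒All : ∀ {m T ls} → Fill m T ls → All (All (Letter m)) T
Fill⇒All []              = []
Fill⇒All ((_ , ok) ∷ rows) = ok ∷ Fill⇒All rows

length-concat-Fill : ∀ {m T ls} → Fill m T ls → length (concat T) ≡ sum ls
length-concat-Fill []                        = refl
length-concat-Fill {T = w ∷ _} ((len , _) ∷ fill) = trans (Listₚ.length-++ w) (cong₂ _+_ len (length-concat-Fill fill))

⊆c-refl : ∀ β → β ⊆c β
⊆c-refl []      = []⊆
⊆c-refl (b ∷ β) = ℕₚ.≤-refl ∷⊆ ⊆c-refl β

⊆c-length : ∀ {β α} → β ⊆c α → length β ≤ length α
⊆c-length []⊆          = z≤n
⊆c-length (_ ∷⊆ β⊆α) = s≤s (⊆c-length β⊆α)

⊆c-size : ∀ {β α} → β ⊆c α → size β ≤ size α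
⊆c-size []⊆            = z≤n
⊆c-size (b≤a ∷⊆ β⊆α) = ℕₚ.+-mono-≤ b≤a (⊆c-size β⊆α)

_⊆c?_ : ∀ β α → Dec (β ⊆c α)
[]      ⊆c? α       = yes []⊆
(b ∷ β) ⊆c? []      = no λ ()
(b ∷ β) ⊆c? (a ∷ α) with b ≤? a | β ⊆c? α
... | yes b≤a | yes β⊆α = yes (b≤a ∷⊆ β⊆α)
... | no  b≰a | _       = no λ { (b≤a ∷⊆ _) → b≰a b≤a }
... | yes _   | no  β⊈α = no λ { (_ ∷⊆ β⊆α) → β⊈α β⊆α }

[j∸i]+[k∸j]≡k∸i : ∀ {i j k} → i ≤ j → j ≤ k → (j ∸ i) + (k ∸ j) ≡ k ∸ i
[j∸i]+[k∸j]≡k∸i {i} {j} {k} i≤j j≤k = begin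
  (j ∸ i) + (k ∸ j)   ≡⟨ ℕₚ.+-∸-assoc (j ∸ i) j≤k ⟨
  (j ∸ i) + k ∸ j     ≡⟨ cong (_∸ j) (ℕₚ.+-∸-comm k i≤j) ⟨
  j + k ∸ i ∸ j       ≡⟨ ℕₚ.∸-+-assoc (j + k) i j ⟩
  j + k ∸ (i + j)     ≡⟨ cong (j + k ∸_) (ℕₚ.+-comm i j) ⟩
  j + k ∸ (j + i)     ≡⟨ ℕₚ.∸-+-assoc (j + k) j i ⟨
  j + k ∸ j ∸ i       ≡⟨ cong (_∸ i) (ℕₚ.m+n∸m≡n j k) ⟩
  k ∸ i               ∎
  where open ≡-Reasoning

rowLengths-[] : ∀ α → rowLengths α [] ≡ α
rowLengths-[] []      = refl
rowLengths-[] (a ∷ α) = cong (a ∷_) (rowLengths-[] α)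

length-rowLengths : ∀ α β → length (rowLengths α β) ≡ length α
length-rowLengths []      β       = refl
length-rowLengths (a ∷ α) []      = cong suc (length-rowLengths α [])
length-rowLengths (a ∷ α) (b ∷ β) = cong suc (length-rowLengths α β)

length-Fill : ∀ {m T} α β → Fill m T (rowLengths α β) → length T ≡ length α
length-Fill α β fill = trans (Pointwise-length fill) (length-rowLengths α β)

sum-rowLengths : ∀ {α β} → β ⊆c α → sum (rowLengths α β) ≡ size α ∸ size β
sum-rowLengths {α} []⊆ = cong sum (rowLengths-[] α)
sum-rowLengths {a ∷ α} {b ∷ β} (b≤a ∷⊆ β⊆α) = begin
  (a ∸ b) + sum (rowLengths α β)   ≡⟨ cong ((a ∸ b) +_) (sum-rowLengths β⊆α) ⟩
  (a ∸ b) + (size α ∸ size β)      ≡⟨ ℕₚ.+-∸-assoc (a ∸ b) (⊆c-size β⊆α) ⟨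
  (a ∸ b) + size α ∸ size β        ≡⟨ cong (_∸ size β) (ℕₚ.+-∸-comm (size α) b≤a) ⟨
  a + size α ∸ b ∸ size β          ≡⟨ ℕₚ.∸-+-assoc (a + size α) b (size β) ⟩
  a + size α ∸ (b + size β)        ∎
  where open ≡-Reasoning

sum-rowLengths≡0 : ∀ {β α} → β ⊆c α → IsComp α → sum (rowLengths α β) ≡ 0 → α ≡ β
sum-rowLengths≡0 {[]}    {[]}        _ _ _ = refl
sum-rowLengths≡0 {[]}    {zero ∷ α}  _ (() ∷ _) _
sum-rowLengths≡0 {b ∷ β} {a ∷ α} (b≤a ∷⊆ β⊆α) (_ ∷ α>0) sum≡0 =
  cong₂ _∷_ (ℕₚ.≤-antisym (ℕₚ.m∸n≡0⇒m≤n (ℕₚ.m+n≡0⇒m≡0 (a ∸ b) sum≡0)) b≤a)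
            (sum-rowLengths≡0 β⊆α α>0 (ℕₚ.m+n≡0⇒n≡0 (a ∸ b) sum≡0))

rowLengths-self : ∀ β → rowLengths β β ≡ map (λ _ → 0) β
rowLengths-self []      = refl
rowLengths-self (b ∷ β) = cong₂ _∷_ (ℕₚ.n∸n≡0 b) (rowLengths-self β)

flat-comp : ∀ c → IsComp (flat c)
flat-comp []          = []
flat-comp (zero ∷ c)  = flat-comp c
flat-comp (suc a ∷ c) = s≤s z≤n ∷ flat-comp c

sum-flat : ∀ c → sum (flat c) ≡ sum c
sum-flat []          = refl
sum-flat (zero ∷ c)  = sum-flat c
sum-flat (suc a ∷ c) = cong (suc a +_) (sum-flat c)

-- Splitting tableaux at a threshold

-- The properties of a relation (≤ or <) that make it survive cutting a sorted word at a threshold m and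
-- gluing two sorted words u, v into u ++ map (m +_) v.
record ShiftStable (R : ℕ → ℕ → Set) : Set where
  field
    dec      : ∀ x y → Dec (R x y)
    ⇒≤       : ∀ {x y} → R x y → x ≤ y
    ∸-mono   : ∀ {m x y} → m ≤ x → R x y → R (x ∸ m) (y ∸ m)
    +-mono   : ∀ {m x y} → R x y → R (m + x) (m + y)
    straddle : ∀ {m x y} → x ≤ m → 0 < y → R x (m + y)

≤-shiftStable : ShiftStable _≤_
≤-shiftStable = record
  { dec      = _≤?_
  ; ⇒≤       = λ x≤y → x≤y
  ; ∸-mono   = λ {m} _ x≤y → ℕₚ.∸-monoˡ-≤ m x≤y
  ; +-mono   = λ {m} x≤y → ℕₚ.+-monoʳ-≤ m x≤y
  ; straddle = λ {m} {y = y} x≤m _ → ℕₚ.≤-trans x≤m (ℕₚ.m≤m+n m y)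
  }

<-shiftStable : ShiftStable _<_
<-shiftStable = record
  { dec      = _<?_
  ; ⇒≤       = ℕₚ.<⇒≤
  ; ∸-mono   = λ m≤x x<y → ℕₚ.∸-monoˡ-< x<y m≤x
  ; +-mono   = λ {m} x<y → ℕₚ.+-monoʳ-< m x<y
  ; straddle = λ {m} x≤m 0<y → ℕₚ.≤-<-trans x≤m (ℕₚ.m<m+n m 0<y)
  }

-- On a sorted row: the entries ≤ m, and the other entries lowered by m.

lowerRow : ℕ → List ℕ → List ℕ
lowerRow m []      = []
lowerRow m (x ∷ w) with x ≤? m
... | yes _ = x ∷ lowerRow m w
... | no  _ = []

upperRow : ℕ → List ℕ → List ℕ
upperRow m []      = []
upperRow m (x ∷ w) with x ≤? m
... | yes _ = upperRow m w
... | no  _ = map (_∸ m) (x ∷ w)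

joinRow : ℕ → List ℕ → List ℕ → List ℕ
joinRow m u v = u ++ map (m +_) v

lowerRow-≤ : ∀ m w → All (_≤ m) (lowerRow m w)
lowerRow-≤ m []      = []
lowerRow-≤ m (x ∷ w) with x ≤? m
... | yes x≤m = x≤m ∷ lowerRow-≤ m w
... | no  _   = []

lowerRow-prefix : ∀ {P : ℕ → Set} m {w} → All P w → All P (lowerRow m w)
lowerRow-prefix m {[]}    []         = []
lowerRow-prefix m {x ∷ w} (px ∷ pw) with x ≤? m
... | yes _ = px ∷ lowerRow-prefix m pw
... | no  _ = []

lowerRow-gt : ∀ {m x} w → m < x → lowerRow m (x ∷ w) ≡ []
lowerRow-gt {m} {x} w m<x with x ≤? m
... | yes x≤m = ⊥-elim (ℕₚ.<⇒≱ m<x x≤m)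
... | no  _   = refl

lowerRow-le : ∀ {m x} w → x ≤ m → lowerRow m (x ∷ w) ≡ x ∷ lowerRow m w
lowerRow-le {m} {x} w x≤m with x ≤? m
... | yes _   = refl
... | no  x≰m = ⊥-elim (x≰m x≤m)

upperRow-gt : ∀ {m x} w → m < x → upperRow m (x ∷ w) ≡ map (_∸ m) (x ∷ w)
upperRow-gt {m} {x} w m<x with x ≤? m
... | yes x≤m = ⊥-elim (ℕₚ.<⇒≱ m<x x≤m)
... | no  _   = refl

upperRow-le : ∀ {m x} w → x ≤ m → upperRow m (x ∷ w) ≡ upperRow m w
upperRow-le {m} {x} w x≤m with x ≤? m
... | yes _   = refl
... | no  x≰m = ⊥-elim (x≰m x≤m)

length-lowerRow+upperRow : ∀ m w → length (lowerRow m w) + length (upperRow m w) ≡ length w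
length-lowerRow+upperRow m []      = refl
length-lowerRow+upperRow m (x ∷ w) with x ≤? m
... | yes _ = cong suc (length-lowerRow+upperRow m w)
... | no  _ = cong suc (Listₚ.length-map (_∸ m) w)

lowerRow-upperRow-joinRow : ∀ m {u v} → All (_≤ m) u → All (0 <_) v → lowerRow m (joinRow m u v) ≡ u × upperRow m (joinRow m u v) ≡ v
lowerRow-upperRow-joinRow m {[]}    {[]}    [] [] = refl , refl
lowerRow-upperRow-joinRow m {[]}    {y ∷ v} [] (0<y ∷ _) = lowerRow-gt _ m<m+y ,
  trans (upperRow-gt _ m<m+y)
        (trans (sym (Listₚ.map-∘ (y ∷ v))) (trans (Listₚ.map-cong (ℕₚ.m+n∸m≡n m) (y ∷ v)) (Listₚ.map-id (y ∷ v))))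
  where
  m<m+y : m < m + y
  m<m+y = ℕₚ.m<m+n m 0<y
lowerRow-upperRow-joinRow m {x ∷ u} (x≤m ∷ u≤m) v>0 =
  let lower , upper = lowerRow-upperRow-joinRow m u≤m v>0 in
  trans (lowerRow-le _ x≤m) (cong (x ∷_) lower) , trans (upperRow-le _ x≤m) upper

module _ {R : ℕ → ℕ → Set} (stable : ShiftStable R) where
  open ShiftStable stable

  Linked⇒All< : ∀ {m x w} → m < x → Linked R (x ∷ w) → All (m <_) (x ∷ w)
  Linked⇒All< m<x l = LinkedP.Linked⇒All ℕₚ.≤-trans m<x (Linked.map ⇒≤ l)

  joinRow-lowerRow-upperRow : ∀ m {w} → Linked R w → joinRow m (lowerRow m w) (upperRow m w) ≡ w
  joinRow-lowerRow-upperRow m {[]}    _ = refl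
  joinRow-lowerRow-upperRow m {x ∷ w} l with x ≤? m
  ... | yes _   = cong (x ∷_) (joinRow-lowerRow-upperRow m (Linked.tail l))
  ... | no  x≰m = trans (sym (Listₚ.map-∘ (x ∷ w)))
    (trans (Listₚ.map-cong-local (All.map (λ m<y → ℕₚ.m+[n∸m]≡n (ℕₚ.<⇒≤ m<y)) (Linked⇒All< (ℕₚ.≰⇒> x≰m) l)))
           (Listₚ.map-id (x ∷ w)))

  lowerRow-linked : ∀ m {w} → Linked R w → Linked R (lowerRow m w)
  lowerRow-linked m {[]}         l       = l
  lowerRow-linked m {x ∷ []}     l       with x ≤? m
  ... | yes _ = [-]
  ... | no  _ = []
  lowerRow-linked m {x ∷ y ∷ w} (r ∷ l) with x ≤? m
  ... | no  _ = []
  ... | yes _ with y ≤? m | lowerRow-linked m {y ∷ w} l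
  ...   | yes _ | ih = r ∷ ih
  ...   | no  _ | _  = [-]

  upperRow-linked : ∀ m {w} → Linked R w → Linked R (upperRow m w)
  upperRow-linked m {[]}    l = []
  upperRow-linked m {x ∷ w} l with x ≤? m
  ... | yes _   = upperRow-linked m (Linked.tail l)
  ... | no  x≰m = LinkedP.map⁺ (shifted (Linked⇒All< (ℕₚ.≰⇒> x≰m) l) l)
    where
    shifted : ∀ {v} → All (m <_) v → Linked R v → Linked (λ a b → R (a ∸ m) (b ∸ m)) v
    shifted _                []        = []
    shifted _                [-]       = [-]
    shifted (m<a ∷ m<v) (r ∷ l′) = ∸-mono (ℕₚ.<⇒≤ m<a) r ∷ shifted m<v l′

  joinRow-linked : ∀ m {u v} → Linked R u → Linked R v → All (_≤ m) u → All (0 <_) v → Linked R (joinRow m u v)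
  joinRow-linked m {[]}        _       lv _           _         = LinkedP.map⁺ (Linked.map +-mono lv)
  joinRow-linked m {x ∷ []}    _       lv _           []        = [-]
  joinRow-linked m {x ∷ []}    _       lv (x≤m ∷ _)  (0<y ∷ v>0) = straddle x≤m 0<y ∷ joinRow-linked m [] lv [] (0<y ∷ v>0)
  joinRow-linked m {x ∷ _ ∷ _} (r ∷ lu) lv (_ ∷ u≤m) v>0 = r ∷ joinRow-linked m lu lv u≤m v>0

  upperRow-letters : ∀ m₁ m₂ {w} → Linked R w → All (Letter (m₁ + m₂)) w → All (Letter m₂) (upperRow m₁ w)
  upperRow-letters m₁ m₂ {[]}    _ []         = []
  upperRow-letters m₁ m₂ {x ∷ w} l (ok ∷ oks) with x ≤? m₁
  ... | yes _   = upperRow-letters m₁ m₂ (Linked.tail l) oks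
  ... | no  x≰m = Allₚ.map⁺ (All.zipWith (λ (m₁<y , ok) → lowered m₁<y ok) (Linked⇒All< (ℕₚ.≰⇒> x≰m) l , ok ∷ oks))
    where
    lowered : ∀ {x} → m₁ < x → Letter (m₁ + m₂) x → Letter m₂ (x ∸ m₁)
    lowered {x} m₁<x (_ , x≤m) = ℕₚ.m<n⇒0<n∸m m₁<x , ℕₚ.m≤n+o⇒m∸n≤o x m₁ x≤m

lowerRow-letters : ∀ m₁ m₂ {w} → All (Letter (m₁ + m₂)) w → All (Letter m₁) (lowerRow m₁ w)
lowerRow-letters m₁ m₂ {w} ok = All.zip (All.map proj₁ (lowerRow-prefix m₁ ok) , lowerRow-≤ m₁ w)

joinRow-letters : ∀ m₁ m₂ {u v} → All (Letter m₁) u → All (Letter m₂) v → All (Letter (m₁ + m₂)) (joinRow m₁ u v)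
joinRow-letters m₁ m₂ oku okv = Allₚ.++⁺ (All.map (λ (0<x , x≤m₁) → 0<x , ℕₚ.≤-trans x≤m₁ (ℕₚ.m≤m+n m₁ m₂)) oku)
  (Allₚ.map⁺ (All.map (λ {y} (0<y , y≤m₂) → ℕₚ.≤-trans 0<y (ℕₚ.m≤n+m y m₁) , ℕₚ.+-monoʳ-≤ m₁ y≤m₂) okv))

-- Splitting a tableau of shape α/β at m: the entries ≤ m form a tableau of some shape σ/β, the others
-- (lowered by m) one of shape α/σ.  Rows of α/β beyond ℓ(β) contribute to σ only until the first one
-- whose first-column entry exceeds m.

lowerPart : ℕ → List ℕ → Filling → List ℕ × Filling
lowerPart m (b ∷ β) (w ∷ T)       = Product.map (b + length (lowerRow m w) ∷_) (lowerRow m w ∷_) (lowerPart m β T)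
lowerPart m []      ((x ∷ w) ∷ T) with x ≤? m
... | yes _ = Product.map (suc (length (lowerRow m w)) ∷_) ((x ∷ lowerRow m w) ∷_) (lowerPart m [] T)
... | no  _ = [] , []
lowerPart m _       _             = [] , []

upperPart : ℕ → Filling → Filling
upperPart m = map (upperRow m)

joinTableau : ℕ → Filling → Filling → Filling
joinTableau m (u ∷ T₁) (v ∷ T₂) = joinRow m u v ∷ joinTableau m T₁ T₂
joinTableau m []       T₂       = map (joinRow m []) T₂
joinTableau m (_ ∷ _)  []       = []

lowerPart-le : ∀ {m x} w T → x ≤ m →
  lowerPart m [] ((x ∷ w) ∷ T) ≡ Product.map (suc (length (lowerRow m w)) ∷_) ((x ∷ lowerRow m w) ∷_) (lowerPart m [] T)
lowerPart-le {m} {x} w T x≤m with x ≤? m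
... | yes _   = refl
... | no  x≰m = ⊥-elim (x≰m x≤m)

lowerPart-gt : ∀ {m x} w T → m < x → lowerPart m [] ((x ∷ w) ∷ T) ≡ ([] , [])
lowerPart-gt {m} {x} w T m<x with x ≤? m
... | yes x≤m = ⊥-elim (ℕₚ.<⇒≱ m<x x≤m)
... | no  _   = refl

firstCol-All : ∀ {P : ℕ → Set} rs {T} → All (All P) T → All P (firstCol rs T)
firstCol-All []                 _                  = []
firstCol-All ((zero , _) ∷ rs)  []                 = []
firstCol-All ((zero , _) ∷ rs)  ([] ∷ oks)        = firstCol-All rs oks
firstCol-All ((zero , _) ∷ rs)  ((ok ∷ _) ∷ oks)  = ok ∷ firstCol-All rs oks
firstCol-All ((suc _ , _) ∷ rs) []                 = []
firstCol-All ((suc _ , _) ∷ rs) (_ ∷ oks)         = firstCol-All rs oks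

emptyFilling : List ℕ → Filling
emptyFilling = map (λ _ → [])

fillings-zeros : ∀ m β → fillings m (map (λ _ → 0) β) ≡ [ emptyFilling β ]
fillings-zeros m []      = refl
fillings-zeros m (b ∷ β) = cong (λ Ts → map ([] ∷_) Ts ++ []) (fillings-zeros m β)

firstCol-emptyFilling : ∀ rs β → firstCol rs (emptyFilling β) ≡ []
firstCol-emptyFilling []                 β       = refl
firstCol-emptyFilling ((zero , _) ∷ rs)  []      = refl
firstCol-emptyFilling ((zero , _) ∷ rs)  (_ ∷ β) = firstCol-emptyFilling rs β
firstCol-emptyFilling ((suc _ , _) ∷ rs) []      = refl
firstCol-emptyFilling ((suc _ , _) ∷ rs) (_ ∷ β) = firstCol-emptyFilling rs β

module _ {Rr Rc : ℕ → ℕ → Set} (row : ShiftStable Rr) (col : ShiftStable Rc) (m₁ m₂ : ℕ) where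

  record Split (α β : List ℕ) (T : Filling) : Set where
    field
      shape        : List ℕ
      lower        : Filling
      lowerPart≡   : lowerPart m₁ β T ≡ (shape , lower)
      β⊆shape      : β ⊆c shape
      shape⊆α      : shape ⊆c α
      shape-comp   : IsComp shape
      lower-fill   : Fill m₁ lower (rowLengths shape β)
      upper-fill   : Fill m₂ (upperPart m₁ T) (rowLengths α shape)
      lower-rows   : All (Linked Rr) lower
      lower-col    : firstCol (skewRows shape β) lower ≡ lowerRow m₁ (firstCol (skewRows α β) T)
      upper-col    : firstCol (skewRows α shape) (upperPart m₁ T) ≡ upperRow m₁ (firstCol (skewRows α β) T)
      rejoin       : joinTableau m₁ lower (upperPart m₁ T) ≡ T

  record AllUpper (α : List ℕ) (T : Filling) : Set where
    field
      upper-fill : Fill m₂ (upperPart m₁ T) (rowLengths α [])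
      upper-col  : firstCol (skewRows α []) (upperPart m₁ T) ≡ map (_∸ m₁) (firstCol (skewRows α []) T)
      rejoin     : joinTableau m₁ [] (upperPart m₁ T) ≡ T

  allUpper : ∀ α {T} → Fill (m₁ + m₂) T (rowLengths α []) → All (Linked Rr) T →
    All (m₁ <_) (firstCol (skewRows α []) T) → AllUpper α T
  allUpper []      []                   []        _              = record { upper-fill = [] ; upper-col = refl ; rejoin = refl }
  allUpper (a ∷ α) {[] ∷ T}     ((len , _) ∷ fill) (_ ∷ rows) col> = record
    { upper-fill = (len , []) ∷ upper-fill
    ; upper-col  = upper-col
    ; rejoin     = cong ([] ∷_) rejoin
    }
    where open AllUpper (allUpper α fill rows col>)
  allUpper (a ∷ α) {(x ∷ w) ∷ T} ((len , ok) ∷ fill) (l ∷ rows) (m₁<x ∷ col>) = record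
    { upper-fill = (trans upper-length len , upperRow-letters row m₁ m₂ l ok) ∷ upper-fill
    ; upper-col  = trans (cong (λ u → firstCol (skewRows (a ∷ α) []) (u ∷ upperPart m₁ T)) (upperRow-gt w m₁<x))
                         (cong (x ∸ m₁ ∷_) upper-col)
    ; rejoin     = cong₂ _∷_ (trans (cong (λ u → joinRow m₁ u (upperRow m₁ (x ∷ w))) (sym (lowerRow-gt w m₁<x)))
                                    (joinRow-lowerRow-upperRow row m₁ l))
                         rejoin
    }
    where
    open AllUpper (allUpper α fill rows col>)
    upper-length : length (upperRow m₁ (x ∷ w)) ≡ length (x ∷ w)
    upper-length = trans (cong length (upperRow-gt w m₁<x)) (Listₚ.length-map (_∸ m₁) (x ∷ w))

  split-allUpper : ∀ {a α x w T} → m₁ < x → Fill (m₁ + m₂) ((x ∷ w) ∷ T) (rowLengths (a ∷ α) []) →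
    All (Linked Rr) ((x ∷ w) ∷ T) → Linked Rc (firstCol (skewRows (a ∷ α) []) ((x ∷ w) ∷ T)) →
    Split (a ∷ α) [] ((x ∷ w) ∷ T)
  split-allUpper {a} {α} {x} {w} {T} m₁<x fill rows lc = record
    { shape = [] ; lower = [] ; lowerPart≡ = lowerPart-gt w T m₁<x
    ; β⊆shape = []⊆ ; shape⊆α = []⊆ ; shape-comp = [] ; lower-fill = [] ; lower-rows = []
    ; upper-fill = upper-fill
    ; lower-col  = sym (lowerRow-gt _ m₁<x)
    ; upper-col  = trans upper-col (sym (upperRow-gt _ m₁<x))
    ; rejoin     = rejoin
    }
    where open AllUpper (allUpper (a ∷ α) fill rows (Linked⇒All< col m₁<x lc))

  split-newRow : ∀ {a α x w T} → x ≤ m₁ → RowFill (m₁ + m₂) (x ∷ w) a → Linked Rr (x ∷ w) →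
    Split α [] T → Split (a ∷ α) [] ((x ∷ w) ∷ T)
  split-newRow {a} {α} {x} {w} {T} x≤m₁ (len , ok) l ih = record
    { shape      = suc k ∷ shape
    ; lower      = (x ∷ lowerRow m₁ w) ∷ lower
    ; lowerPart≡ = trans (lowerPart-le w T x≤m₁) (cong (Product.map (suc k ∷_) ((x ∷ lowerRow m₁ w) ∷_)) lowerPart≡)
    ; β⊆shape    = []⊆
    ; shape⊆α    = subst (suc k ≤_) lengths (ℕₚ.m≤m+n (suc k) _) ∷⊆ shape⊆α
    ; shape-comp = s≤s z≤n ∷ shape-comp
    ; lower-fill = (refl , subst (All (Letter m₁)) low≡ (lowerRow-letters m₁ m₂ ok)) ∷ lower-fill
    ; upper-fill = (trans (sym (ℕₚ.m+n∸m≡n (suc k) _)) (cong (_∸ suc k) lengths) , upperRow-letters row m₁ m₂ l ok)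
                   ∷ upper-fill
    ; lower-rows = subst (Linked Rr) low≡ (lowerRow-linked row m₁ l) ∷ lower-rows
    ; lower-col  = trans (cong (x ∷_) lower-col) (sym (lowerRow-le _ x≤m₁))
    ; upper-col  = trans upper-col (sym (upperRow-le _ x≤m₁))
    ; rejoin     = cong₂ _∷_ (trans (cong (λ u → joinRow m₁ u (upperRow m₁ (x ∷ w))) (sym low≡)) (joinRow-lowerRow-upperRow row m₁ l))
                             rejoin
    }
    where
    open Split ih
    k : ℕ
    k = length (lowerRow m₁ w)
    low≡ : lowerRow m₁ (x ∷ w) ≡ x ∷ lowerRow m₁ w
    low≡ = lowerRow-le w x≤m₁
    lengths : suc k + length (upperRow m₁ (x ∷ w)) ≡ a
    lengths = trans (cong (λ u → length u + length (upperRow m₁ (x ∷ w))) (sym low≡))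
                    (trans (length-lowerRow+upperRow m₁ (x ∷ w)) len)

  split-∷ : ∀ {a α b β w T} → suc b ≤ a → RowFill (m₁ + m₂) w (a ∸ suc b) → Linked Rr w →
    Split α β T → Split (a ∷ α) (suc b ∷ β) (w ∷ T)
  split-∷ {a} {α} {b} {β} {w} {T} b<a (len , ok) l ih = record
    { shape      = suc b + k ∷ shape
    ; lower      = lowerRow m₁ w ∷ lower
    ; lowerPart≡ = cong (Product.map (suc b + k ∷_) (lowerRow m₁ w ∷_)) lowerPart≡
    ; β⊆shape    = ℕₚ.m≤m+n (suc b) k ∷⊆ β⊆shape
    ; shape⊆α    = subst (suc b + k ≤_) (ℕₚ.m+[n∸m]≡n b<a) (ℕₚ.+-monoʳ-≤ (suc b) (subst (k ≤_) lengths (ℕₚ.m≤m+n k _)))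
                   ∷⊆ shape⊆α
    ; shape-comp = s≤s z≤n ∷ shape-comp
    ; lower-fill = (sym (ℕₚ.m+n∸m≡n (suc b) k) , lowerRow-letters m₁ m₂ ok) ∷ lower-fill
    ; upper-fill = (upper-length , upperRow-letters row m₁ m₂ l ok) ∷ upper-fill
    ; lower-rows = lowerRow-linked row m₁ l ∷ lower-rows
    ; lower-col  = lower-col
    ; upper-col  = upper-col
    ; rejoin     = cong₂ _∷_ (joinRow-lowerRow-upperRow row m₁ l) rejoin
    }
    where
    open Split ih
    k : ℕ
    k = length (lowerRow m₁ w)
    lengths : k + length (upperRow m₁ w) ≡ a ∸ suc b
    lengths = trans (length-lowerRow+upperRow m₁ w) len
    upper-length : length (upperRow m₁ w) ≡ a ∸ (suc b + k)
    upper-length = sym (trans (sym (ℕₚ.∸-+-assoc a (suc b) k)) (trans (cong (_∸ k) (sym lengths)) (ℕₚ.m+n∸m≡n k _)))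

  split : ∀ α β {T} → IsComp α → IsComp β → β ⊆c α → Fill (m₁ + m₂) T (rowLengths α β) →
    All (Linked Rr) T → Linked Rc (firstCol (skewRows α β) T) → Split α β T
  split []      []      _         _ _ [] _ _ = record
    { shape = [] ; lower = [] ; lowerPart≡ = refl ; β⊆shape = []⊆ ; shape⊆α = []⊆ ; shape-comp = []
    ; lower-fill = [] ; upper-fill = [] ; lower-rows = [] ; lower-col = refl ; upper-col = refl ; rejoin = refl }
  split (a ∷ α) [] {[] ∷ T} (a>0 ∷ _) _ _ ((len , _) ∷ _) _ _ = ⊥-elim (ℕₚ.<⇒≢ a>0 len)
  split (a ∷ α) [] {(x ∷ w) ∷ T} (_ ∷ α>0) β>0 β⊆α (row ∷ fill) (l ∷ rows) lc with x ≤? m₁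
  ... | yes x≤m₁ = split-newRow x≤m₁ row l (split α [] α>0 β>0 []⊆ fill rows (Linked.tail lc))
  ... | no  x≰m₁ = split-allUpper (ℕₚ.≰⇒> x≰m₁) (row ∷ fill) (l ∷ rows) lc
  split (a ∷ α) (suc b ∷ β) {w ∷ T} (_ ∷ α>0) (_ ∷ β>0) (b<a ∷⊆ β⊆α) (row ∷ fill) (l ∷ rows) lc =
    split-∷ b<a row l (split α β α>0 β>0 β⊆α fill rows lc)

  record Join (α β shape : List ℕ) (T₁ T₂ : Filling) : Set where
    field
      join-fill      : Fill (m₁ + m₂) (joinTableau m₁ T₁ T₂) (rowLengths α β)
      join-rows      : All (Linked Rr) (joinTableau m₁ T₁ T₂)
      join-col       : firstCol (skewRows α β) (joinTableau m₁ T₁ T₂)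
                       ≡ joinRow m₁ (firstCol (skewRows shape β) T₁) (firstCol (skewRows α shape) T₂)
      lowerPart-join : lowerPart m₁ β (joinTableau m₁ T₁ T₂) ≡ (shape , T₁)
      upperPart-join : upperPart m₁ (joinTableau m₁ T₁ T₂) ≡ T₂

  length-joinRow : ∀ u v → length (joinRow m₁ u v) ≡ length u + length v
  length-joinRow u v = trans (Listₚ.length-++ u) (cong (length u +_) (Listₚ.length-map (m₁ +_) v))

  join-allUpper : ∀ α {T₂} → Fill m₂ T₂ (rowLengths α []) → All (Linked Rr) T₂ → Join α [] [] [] T₂
  join-allUpper []      []                    []        = record
    { join-fill = [] ; join-rows = [] ; join-col = refl ; lowerPart-join = refl ; upperPart-join = refl }
  join-allUpper (a ∷ α) {w ∷ T₂} ((len , ok) ∷ fill) (l ∷ rows) = record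
    { join-fill      = (trans (Listₚ.length-map (m₁ +_) w) len , joinRow-letters m₁ m₂ [] ok) ∷ join-fill
    ; join-rows      = joinRow-linked row m₁ [] l [] (All.map proj₁ ok) ∷ join-rows
    ; join-col       = join-col′ w
    ; lowerPart-join = lowerPart-allUpper w ok
    ; upperPart-join = cong₂ _∷_ (proj₂ (lowerRow-upperRow-joinRow m₁ [] (All.map proj₁ ok))) upperPart-join
    }
    where
    open Join (join-allUpper α fill rows)
    join-col′ : ∀ w →
      firstCol (skewRows (a ∷ α) []) (joinTableau m₁ [] (w ∷ T₂)) ≡ map (m₁ +_) (firstCol (skewRows (a ∷ α) []) (w ∷ T₂))
    join-col′ []      = join-col
    join-col′ (y ∷ _) = cong (m₁ + y ∷_) join-col
    lowerPart-allUpper : ∀ w → All (Letter m₂) w → lowerPart m₁ [] (joinTableau m₁ [] (w ∷ T₂)) ≡ ([] , [])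
    lowerPart-allUpper []      _               = refl
    lowerPart-allUpper (y ∷ _) ((0<y , _) ∷ _) = lowerPart-gt _ _ (ℕₚ.m<m+n m₁ 0<y)

  join-newRow : ∀ {a α s shape x v w T₁ T₂} → RowFill m₁ (x ∷ v) (suc s) → RowFill m₂ w (a ∸ suc s) →
    Linked Rr (x ∷ v) → Linked Rr w → suc s ≤ a →
    Join α [] shape T₁ T₂ → Join (a ∷ α) [] (suc s ∷ shape) ((x ∷ v) ∷ T₁) (w ∷ T₂)
  join-newRow {a} {α} {s} {shape} {x} {v} {w} {T₁} {T₂} (len₁ , ok₁) (len₂ , ok₂) l₁ l₂ s<a ih = record
    { join-fill      = (trans (length-joinRow (x ∷ v) w) (trans (cong₂ _+_ len₁ len₂) (ℕₚ.m+[n∸m]≡n s<a)) ,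
                        joinRow-letters m₁ m₂ ok₁ ok₂) ∷ join-fill
    ; join-rows      = joinRow-linked row m₁ l₁ l₂ (All.map proj₂ ok₁) (All.map proj₁ ok₂) ∷ join-rows
    ; join-col       = cong (x ∷_) join-col
    ; lowerPart-join = trans (lowerPart-le (joinRow m₁ v w) (joinTableau m₁ T₁ T₂) (proj₂ (All.head ok₁)))
                         (trans (cong₂ (λ u → Product.map (suc (length u) ∷_) ((x ∷ u) ∷_)) lower≡ lowerPart-join)
                                (cong (λ n → (n ∷ shape , (x ∷ v) ∷ T₁)) len₁))
    ; upperPart-join = cong₂ _∷_ (trans (upperRow-le _ (proj₂ (All.head ok₁))) upper≡) upperPart-join
    }
    where
    open Join ih
    lower≡ : lowerRow m₁ (joinRow m₁ v w) ≡ v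
    lower≡ = proj₁ (lowerRow-upperRow-joinRow m₁ (All.map proj₂ (All.tail ok₁)) (All.map proj₁ ok₂))
    upper≡ : upperRow m₁ (joinRow m₁ v w) ≡ w
    upper≡ = proj₂ (lowerRow-upperRow-joinRow m₁ (All.map proj₂ (All.tail ok₁)) (All.map proj₁ ok₂))

  join-∷ : ∀ {a α b β s shape u w T₁ T₂} → RowFill m₁ u (s ∸ suc b) → RowFill m₂ w (a ∸ s) →
    Linked Rr u → Linked Rr w → suc b ≤ s → s ≤ a →
    Join α β shape T₁ T₂ → Join (a ∷ α) (suc b ∷ β) (s ∷ shape) (u ∷ T₁) (w ∷ T₂)
  join-∷ {a} {α} {b} {β} {suc s} {shape} {u} {w} {T₁} {T₂} (len₁ , ok₁) (len₂ , ok₂) l₁ l₂ b<s s≤a ih = record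
    { join-fill      = (trans (length-joinRow u w) (trans (cong₂ _+_ len₁ len₂) ([j∸i]+[k∸j]≡k∸i b<s s≤a)) ,
                        joinRow-letters m₁ m₂ ok₁ ok₂) ∷ join-fill
    ; join-rows      = joinRow-linked row m₁ l₁ l₂ (All.map proj₂ ok₁) (All.map proj₁ ok₂) ∷ join-rows
    ; join-col       = join-col
    ; lowerPart-join = trans (cong₂ (λ u′ → Product.map (suc b + length u′ ∷_) (u′ ∷_)) lower≡ lowerPart-join)
                             (cong (λ n → (n ∷ shape , u ∷ T₁)) (trans (cong (suc b +_) len₁) (ℕₚ.m+[n∸m]≡n b<s)))
    ; upperPart-join = cong₂ _∷_ upper≡ upperPart-join
    }
    where
    open Join ih
    lower≡ : lowerRow m₁ (joinRow m₁ u w) ≡ u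
    lower≡ = proj₁ (lowerRow-upperRow-joinRow m₁ (All.map proj₂ ok₁) (All.map proj₁ ok₂))
    upper≡ : upperRow m₁ (joinRow m₁ u w) ≡ w
    upper≡ = proj₂ (lowerRow-upperRow-joinRow m₁ (All.map proj₂ ok₁) (All.map proj₁ ok₂))

  join : ∀ α β shape {T₁ T₂} → IsComp β → IsComp shape → β ⊆c shape → shape ⊆c α →
    Fill m₁ T₁ (rowLengths shape β) → Fill m₂ T₂ (rowLengths α shape) →
    All (Linked Rr) T₁ → All (Linked Rr) T₂ → Join α β shape T₁ T₂
  join α [] [] _ _ _ _ [] fill₂ _ rows₂ = join-allUpper α fill₂ rows₂
  join (a ∷ α) [] (s ∷ shape) {[] ∷ _} _ (s>0 ∷ _) _ _ ((len , _) ∷ _) _ _ _ = ⊥-elim (ℕₚ.<⇒≢ s>0 len)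
  join (a ∷ α) [] (suc s ∷ shape) {(x ∷ v) ∷ T₁} {w ∷ T₂} β>0 (_ ∷ shape>0) _ (s<a ∷⊆ s⊆α)
       (row₁ ∷ fill₁) (row₂ ∷ fill₂) (l₁ ∷ rows₁) (l₂ ∷ rows₂) =
    join-newRow row₁ row₂ l₁ l₂ s<a (join α [] shape β>0 shape>0 []⊆ s⊆α fill₁ fill₂ rows₁ rows₂)
  join (a ∷ α) (suc b ∷ β) (s ∷ shape) {u ∷ T₁} {w ∷ T₂} (_ ∷ β>0) (_ ∷ shape>0) (b<s ∷⊆ β⊆s) (s≤a ∷⊆ s⊆α)
       (row₁ ∷ fill₁) (row₂ ∷ fill₂) (l₁ ∷ rows₁) (l₂ ∷ rows₂) =
    join-∷ row₁ row₂ l₁ l₂ b<s s≤a (join α β shape β>0 shape>0 β⊆s s⊆α fill₁ fill₂ rows₁ rows₂)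

count-++ : ∀ i xs ys → count i (xs ++ ys) ≡ count i xs + count i ys
count-++ i xs ys = trans (cong length (Listₚ.filter-++ (i ≟_) xs ys)) (Listₚ.length-++ (filter (i ≟_) xs))

count-none : ∀ {i} xs → All (i ≢_) xs → count i xs ≡ 0
count-none _ none = cong length (Listₚ.filter-none (_ ≟_) none)

count-singleton : ∀ x → count x [ x ] ≡ 1
count-singleton x = cong length (Listₚ.filter-accept (x ≟_) refl)

count-map-+ : ∀ m j xs → count (m + j) (map (m +_) xs) ≡ count j xs
count-map-+ m j []       = refl
count-map-+ m j (x ∷ xs) with j ≟ x
... | yes refl = trans (cong length (Listₚ.filter-accept ((m + j) ≟_) refl))
                       (trans (cong suc (count-map-+ m j xs)) (sym (cong length (Listₚ.filter-accept (j ≟_) {xs = xs} refl))))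
... | no  j≢x  = trans (cong length (Listₚ.filter-reject ((m + j) ≟_) (j≢x ∘ ℕₚ.+-cancelˡ-≡ m j x)))
                       (trans (count-map-+ m j xs) (sym (cong length (Listₚ.filter-reject (j ≟_) {xs = xs} j≢x))))

∑-count : ∀ {L} xs → Unique L → All (_∈ L) xs → ∑ (λ i → count i xs) L ≡ length xs
∑-count {L} []       _  []          = ∑-*ˡ 0 (λ _ → 0) L
∑-count {L} (x ∷ xs) !L (x∈ ∷ xs∈) = begin
  ∑ (λ i → count i (x ∷ xs)) L                     ≡⟨ ∑-cong-local L (All.tabulate λ {i} _ → count-++ i [ x ] xs) ⟩
  ∑ (λ i → count i [ x ] + count i xs) L           ≡⟨ ∑-+ (λ i → count i [ x ]) (λ i → count i xs) L ⟩
  ∑ (λ i → count i [ x ]) L + ∑ (λ i → count i xs) L ≡⟨ cong₂ _+_ singleton (∑-count xs !L xs∈) ⟩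
  suc (length xs)                                   ∎
  where
  open ≡-Reasoning
  singleton : ∑ (λ i → count i [ x ]) L ≡ 1
  singleton = trans (∑-cong-local L (All.tabulate λ _ → sym (ℕₚ.*-identityʳ _)))
    (∑-delta L (λ i → count i [ x ]) (λ _ → 1) !L x∈ (λ _ i≢x → count-none [ x ] (i≢x ∷ [])) (count-singleton x))

applyUpTo-+ : ∀ (f : ℕ → A) a b → applyUpTo f (a + b) ≡ applyUpTo f a ++ applyUpTo (f ∘ (a +_)) b
applyUpTo-+ f zero    b = refl
applyUpTo-+ f (suc a) b = cong (f 0 ∷_) (applyUpTo-+ (f ∘ suc) a b)

letters-+ : ∀ m₁ m₂ → letters (m₁ + m₂) ≡ letters m₁ ++ map (m₁ +_) (letters m₂)
letters-+ m₁ m₂ = begin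
  map suc (upTo (m₁ + m₂))                            ≡⟨ cong (map suc) (applyUpTo-+ (λ i → i) m₁ m₂) ⟩
  map suc (upTo m₁ ++ applyUpTo (m₁ +_) m₂)           ≡⟨ Listₚ.map-++ suc (upTo m₁) _ ⟩
  letters m₁ ++ map suc (applyUpTo (m₁ +_) m₂)        ≡⟨ cong (letters m₁ ++_) shifted ⟩
  letters m₁ ++ map (m₁ +_) (letters m₂)              ∎
  where
  open ≡-Reasoning
  shifted : map suc (applyUpTo (m₁ +_) m₂) ≡ map (m₁ +_) (letters m₂)
  shifted = begin
    map suc (applyUpTo (m₁ +_) m₂)    ≡⟨ cong (map suc) (Listₚ.map-applyUpTo (λ i → i) (m₁ +_) m₂) ⟨
    map suc (map (m₁ +_) (upTo m₂))   ≡⟨ Listₚ.map-∘ (upTo m₂) ⟨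
    map (suc ∘ (m₁ +_)) (upTo m₂)     ≡⟨ Listₚ.map-cong (λ i → sym (ℕₚ.+-suc m₁ i)) (upTo m₂) ⟩
    map ((m₁ +_) ∘ suc) (upTo m₂)     ≡⟨ Listₚ.map-∘ (upTo m₂) ⟩
    map (m₁ +_) (letters m₂)          ∎

length-content : ∀ m T → length (content m T) ≡ m
length-content m T = trans (Listₚ.length-map _ (letters m)) (trans (Listₚ.length-map suc (upTo m)) (Listₚ.length-upTo m))

sum-content : ∀ m T → All (All (Letter m)) T → sum (content m T) ≡ length (concat T)
sum-content m T ok = trans (sum-map _ (letters m)) (∑-count (concat T) (letters-unique m) (All.map ∈-letters⁺ (Allₚ.concat⁺ ok)))

count-joinTableau : ∀ m i T₁ T₂ → length T₁ ≤ length T₂ →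
  count i (concat (joinTableau m T₁ T₂)) ≡ count i (concat T₁) + count i (map (m +_) (concat T₂))
count-joinTableau m i []       T₂       _         = cong (count i) (Listₚ.concat-map T₂)
count-joinTableau m i (u ∷ T₁) (v ∷ T₂) (s≤s len) = begin
  count i (joinRow m u v ++ concat (joinTableau m T₁ T₂))
    ≡⟨ count-++ i (joinRow m u v) (concat (joinTableau m T₁ T₂)) ⟩
  count i (u ++ map (m +_) v) + count i (concat (joinTableau m T₁ T₂))
    ≡⟨ cong₂ _+_ (count-++ i u (map (m +_) v)) (count-joinTableau m i T₁ T₂ len) ⟩
  (count i u + count i (map (m +_) v)) + (count i (concat T₁) + count i (map (m +_) (concat T₂)))
    ≡⟨ interchange (count i u) _ _ _ ⟩
  (count i u + count i (concat T₁)) + (count i (map (m +_) v) + count i (map (m +_) (concat T₂)))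
    ≡⟨ cong₂ _+_ (count-++ i u (concat T₁)) upper ⟨
  count i (u ++ concat T₁) + count i (map (m +_) (v ++ concat T₂))
    ∎
  where
  open ≡-Reasoning
  upper : count i (map (m +_) (v ++ concat T₂)) ≡ count i (map (m +_) v) + count i (map (m +_) (concat T₂))
  upper = trans (cong (count i) (Listₚ.map-++ (m +_) v (concat T₂))) (count-++ i (map (m +_) v) (map (m +_) (concat T₂)))

content-joinTableau : ∀ m₁ m₂ {T₁ T₂} → length T₁ ≤ length T₂ → All (All (Letter m₁)) T₁ → All (All (Letter m₂)) T₂ →
  content (m₁ + m₂) (joinTableau m₁ T₁ T₂) ≡ content m₁ T₁ ++ content m₂ T₂
content-joinTableau m₁ m₂ {T₁} {T₂} len ok₁ ok₂ = begin
  map #J (letters (m₁ + m₂))                                 ≡⟨ cong (map #J) (letters-+ m₁ m₂) ⟩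
  map #J (letters m₁ ++ map (m₁ +_) (letters m₂))            ≡⟨ Listₚ.map-++ #J (letters m₁) _ ⟩
  map #J (letters m₁) ++ map #J (map (m₁ +_) (letters m₂))   ≡⟨ cong₂ _++_ lower (trans (sym (Listₚ.map-∘ (letters m₂))) upper) ⟩
  content m₁ T₁ ++ content m₂ T₂                             ∎
  where
  open ≡-Reasoning
  #J : ℕ → ℕ
  #J i = count i (concat (joinTableau m₁ T₁ T₂))
  shifted>m₁ : All (m₁ <_) (map (m₁ +_) (concat T₂))
  shifted>m₁ = Allₚ.map⁺ (All.map (λ (0<y , _) → ℕₚ.m<m+n m₁ 0<y) (Allₚ.concat⁺ ok₂))
  lower≤m₁ : All (_≤ m₁) (concat T₁)
  lower≤m₁ = All.map proj₂ (Allₚ.concat⁺ ok₁)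
  lower : map #J (letters m₁) ≡ content m₁ T₁
  lower = Listₚ.map-cong-local {xs = letters m₁} (All.tabulate λ {i} i∈ →
    trans (count-joinTableau m₁ i T₁ T₂ len)
          (trans (cong (count i (concat T₁) +_) (count-none _ (All.map (i≢ (proj₂ (∈-letters⁻ i∈))) shifted>m₁)))
                 (ℕₚ.+-identityʳ _)))
    where
    i≢ : ∀ {i y} → i ≤ m₁ → m₁ < y → i ≢ y
    i≢ i≤m₁ m₁<y = ℕₚ.<⇒≢ (ℕₚ.≤-<-trans i≤m₁ m₁<y)
  upper : map (#J ∘ (m₁ +_)) (letters m₂) ≡ content m₂ T₂
  upper = Listₚ.map-cong-local {xs = letters m₂} (All.tabulate λ {j} j∈ →
    trans (count-joinTableau m₁ (m₁ + j) T₁ T₂ len)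
          (trans (cong (_+ count (m₁ + j) (map (m₁ +_) (concat T₂))) (count-none _ (All.map (≢m₁+ (proj₁ (∈-letters⁻ j∈))) lower≤m₁)))
                 (count-map-+ m₁ j (concat T₂))))
    where
    ≢m₁+ : ∀ {j x} → 0 < j → x ≤ m₁ → m₁ + j ≢ x
    ≢m₁+ 0<j x≤m₁ = ℕₚ.>⇒≢ (ℕₚ.≤-<-trans x≤m₁ (ℕₚ.m<m+n m₁ 0<j))

subcompositions : List ℕ → List (List ℕ)
subcompositions []      = [ [] ]
subcompositions (a ∷ α) = [] ∷ cartesianProductWith _∷_ (letters a) (subcompositions α)

∈-subcompositions⁻ : ∀ α {γ} → γ ∈ subcompositions α → γ ⊆c α × IsComp γ
∈-subcompositions⁻ []      (here refl) = []⊆ , []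
∈-subcompositions⁻ (a ∷ α) (here refl) = []⊆ , []
∈-subcompositions⁻ (a ∷ α) (there γ∈)
  with _ , _ , c∈ , γ′∈ , refl ← ∈-cartesianProductWith⁻ _∷_ (letters a) (subcompositions α) γ∈
  = let γ′⊆α , γ′>0 = ∈-subcompositions⁻ α γ′∈ ; c>0 , c≤a = ∈-letters⁻ c∈ in (c≤a ∷⊆ γ′⊆α) , (c>0 ∷ γ′>0)

∈-subcompositions⁺ : ∀ {α γ} → γ ⊆c α → IsComp γ → γ ∈ subcompositions α
∈-subcompositions⁺ {[]}    []⊆            []           = here refl
∈-subcompositions⁺ {a ∷ α} []⊆            []           = here refl
∈-subcompositions⁺ {a ∷ α} (c≤a ∷⊆ γ⊆α) (c>0 ∷ γ>0) =
  there (∈-cartesianProductWith⁺ _∷_ (∈-letters⁺ (c>0 , c≤a)) (∈-subcompositions⁺ γ⊆α γ>0))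

subcompositions-unique : ∀ α → Unique (subcompositions α)
subcompositions-unique []      = [] ∷ []
subcompositions-unique (a ∷ α) =
  All.tabulate (λ γ∈ e → []≢∷ γ∈ e) ∷
  Uniqueₚ.cartesianProductWith⁺ _∷_ Listₚ.∷-injective (letters-unique a) (subcompositions-unique α)
  where
  []≢∷ : ∀ {γ} → γ ∈ cartesianProductWith _∷_ (letters a) (subcompositions α) → [] ≢ γ
  []≢∷ γ∈ with _ , _ , _ , _ , refl ← ∈-cartesianProductWith⁻ _∷_ (letters a) (subcompositions α) γ∈ = λ ()

between : List ℕ → List ℕ → List (List ℕ)
between β α = filter (β ⊆c?_) (subcompositions α)

∈-between⁻ : ∀ {β} α {γ} → γ ∈ between β α → β ⊆c γ × γ ⊆c α × IsComp γ
∈-between⁻ {β} α γ∈ =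
  let γ∈α , β⊆γ = ∈-filter⁻ (β ⊆c?_) γ∈ ; γ⊆α , γ>0 = ∈-subcompositions⁻ α γ∈α in β⊆γ , γ⊆α , γ>0

∈-between⁺ : ∀ {β α γ} → β ⊆c γ → γ ⊆c α → IsComp γ → γ ∈ between β α
∈-between⁺ {β} β⊆γ γ⊆α γ>0 = ∈-filter⁺ (β ⊆c?_) (∈-subcompositions⁺ γ⊆α γ>0) β⊆γ

between-unique : ∀ β α → Unique (between β α)
between-unique β α = Uniqueₚ.filter⁺ (β ⊆c?_) (subcompositions-unique α)

∈-comps⁻ : ∀ n {γ} → γ ∈ comps n → IsComp γ × sum γ ≡ n
∈-comps⁻ zero    (here refl) = [] , refl
∈-comps⁻ (suc n) γ∈ with find (∈-concatMap⁻ _ {xs = comps n} γ∈)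
... | []    , γ′∈ , here refl         = s≤s z≤n ∷ [] , cong suc (proj₂ (∈-comps⁻ n γ′∈))
... | a ∷ γ , γ′∈ , here refl         = let γ′>0 , sum≡ = ∈-comps⁻ n γ′∈ in s≤s z≤n ∷ γ′>0 , cong suc sum≡
... | a ∷ γ , γ′∈ , there (here refl) = let γ′>0 , sum≡ = ∈-comps⁻ n γ′∈ in s≤s z≤n ∷ All.tail γ′>0 , cong suc sum≡

∈-comps⁺ : ∀ n {γ} → IsComp γ → sum γ ≡ n → γ ∈ comps n
∈-comps⁺ zero    {[]}                  _         _   = here refl
∈-comps⁺ zero    {zero ∷ _}            (() ∷ _)  _
∈-comps⁺ (suc n) {suc zero ∷ []}      _         sum≡ = ∈-concatMap⁺ _ (lose (∈-comps⁺ n [] (ℕₚ.suc-injective sum≡)) (here refl))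
∈-comps⁺ (suc n) {suc zero ∷ b ∷ γ}   (_ ∷ γ>0) sum≡ =
  ∈-concatMap⁺ _ (lose (∈-comps⁺ n γ>0 (ℕₚ.suc-injective sum≡)) (here refl))
∈-comps⁺ (suc n) {suc (suc a) ∷ γ}    (_ ∷ γ>0) sum≡ =
  ∈-concatMap⁺ _ (lose (∈-comps⁺ n (s≤s z≤n ∷ γ>0) (ℕₚ.suc-injective sum≡)) (there (here refl)))

addFirstBox : List ℕ → List (List ℕ)
addFirstBox []      = [ 1 ∷ [] ]
addFirstBox (a ∷ γ) = (1 ∷ a ∷ γ) ∷ (suc a ∷ γ) ∷ []

removeFirstBox : List ℕ → List ℕ
removeFirstBox (suc zero ∷ γ)    = γ
removeFirstBox (suc (suc a) ∷ γ) = suc a ∷ γ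
removeFirstBox _                 = []

comps-unique : ∀ n → Unique (comps n)
comps-unique zero    = [] ∷ []
comps-unique (suc n) =
  subst Unique (sym comps-suc) (unique-concatMap addFirstBox removeFirstBox (comps-unique n) added-unique removeFirstBox-added)
  where
  comps-suc : comps (suc n) ≡ concatMap addFirstBox (comps n)
  comps-suc = Listₚ.concatMap-cong (λ { [] → refl ; (_ ∷ _) → refl }) (comps n)
  added-unique : ∀ {γ} → γ ∈ comps n → Unique (addFirstBox γ)
  added-unique {[]}    _ = [] ∷ []
  added-unique {a ∷ γ} _ = ((λ e → ℕₚ.1+n≢n (cong length (Listₚ.∷-injectiveʳ e))) ∷ []) ∷ [] ∷ []
  removeFirstBox-added : ∀ {γ δ} → γ ∈ comps n → δ ∈ addFirstBox γ → removeFirstBox δ ≡ γ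
  removeFirstBox-added {[]}         _  (here refl)         = refl
  removeFirstBox-added {a ∷ γ}      _  (here refl)         = refl
  removeFirstBox-added {suc a ∷ γ}  _  (there (here refl)) = refl
  removeFirstBox-added {zero ∷ γ}   γ∈ (there (here refl)) with () ∷ _ ← proj₁ (∈-comps⁻ n γ∈)

sumℤ-cong-local : {f g : A → ℤ} (xs : List A) → All (λ x → f x ≡ g x) xs → sumℤ (map f xs) ≡ sumℤ (map g xs)
sumℤ-cong-local xs eqs = cong sumℤ (Listₚ.map-cong-local eqs)

sumℤ-zero : {f : A → ℤ} (xs : List A) → All (λ x → f x ≡ 0ℤ) xs → sumℤ (map f xs) ≡ 0ℤ
sumℤ-zero []       []         = refl
sumℤ-zero (x ∷ xs) (eq ∷ eqs) = cong₂ ℤ._+_ eq (sumℤ-zero xs eqs)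

sumℤ-+ : (f g : A → ℤ) (xs : List A) → sumℤ (map f xs) ℤ.+ sumℤ (map g xs) ≡ sumℤ (map (λ x → f x ℤ.+ g x) xs)
sumℤ-+ f g []       = refl
sumℤ-+ f g (x ∷ xs) = trans (interchangeℤ (f x) (sumℤ (map f xs)) (g x) (sumℤ (map g xs))) (cong (ℤ._+_ (f x ℤ.+ g x)) (sumℤ-+ f g xs))

sumℤ-*ˡ : (k : ℤ) (f : A → ℤ) (xs : List A) → k ℤ.* sumℤ (map f xs) ≡ sumℤ (map (λ x → k ℤ.* f x) xs)
sumℤ-*ˡ k f []       = ℤₚ.*-zeroʳ k
sumℤ-*ˡ k f (x ∷ xs) = trans (ℤₚ.*-distribˡ-+ k (f x) _) (cong (ℤ._+_ (k ℤ.* f x)) (sumℤ-*ˡ k f xs))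

+-∑ : (f : A → ℕ) (xs : List A) → ℤ.+ ∑ f xs ≡ sumℤ (map (λ x → ℤ.+ f x) xs)
+-∑ f []       = refl
+-∑ f (x ∷ xs) = trans (ℤₚ.pos-+ (f x) (∑ f xs)) (cong (ℤ._+_ (ℤ.+ f x)) (+-∑ f xs))

kron-refl : ∀ x → kron x x ≡ 1ℤ
kron-refl x with ≡-dec _≟_ x x
... | yes _  = refl
... | no x≢x = ⊥-elim (x≢x refl)

kron-≢ : ∀ {x y} → x ≢ y → kron x y ≡ 0ℤ
kron-≢ {x} {y} x≢y with ≡-dec _≟_ x y
... | yes x≡y = ⊥-elim (x≢y x≡y)
... | no  _   = refl

sumℤ-kron-∉ : (xs : List (List ℕ)) {y : List ℕ} (h : List ℕ → ℤ) → y ∉ xs → sumℤ (map (λ x → h x ℤ.* kron x y) xs) ≡ 0ℤ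
sumℤ-kron-∉ xs h y∉ = sumℤ-zero xs (All.tabulate λ {x} x∈ →
  trans (cong (h x ℤ.*_) (kron-≢ λ x≡y → y∉ (subst (_∈ xs) x≡y x∈))) (ℤₚ.*-zeroʳ (h x)))

sumℤ-kron : (xs : List (List ℕ)) {y : List ℕ} (h : List ℕ → ℤ) → Unique xs → y ∈ xs → sumℤ (map (λ x → h x ℤ.* kron x y) xs) ≡ h y
sumℤ-kron (x ∷ xs) h (x∉ ∷ _) (here refl) =
  trans (cong₂ ℤ._+_ (trans (cong (h x ℤ.*_) (kron-refl x)) (ℤₚ.*-identityʳ (h x)))
                     (sumℤ-kron-∉ xs h (λ x∈ → All.lookup x∉ x∈ refl)))
        (ℤₚ.+-identityʳ (h x))
sumℤ-kron (x ∷ xs) h (x∉ ∷ !xs) (there y∈) =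
  trans (cong (ℤ._+ sumℤ (map (λ x′ → h x′ ℤ.* kron x′ _) xs))
              (trans (cong (h x ℤ.*_) (kron-≢ (All.lookup x∉ y∈))) (ℤₚ.*-zeroʳ (h x))))
        (trans (ℤₚ.+-identityˡ _) (sumℤ-kron xs h !xs y∈))

⟪·h⟫ : ∀ x γ F → ⟪ x ·h γ , F ⟫ ≡ ⟪ x , (λ δ → F (δ ++ γ)) ⟫
⟪·h⟫ []            γ F = refl
⟪·h⟫ ((k , δ) ∷ x) γ F = cong (ℤ._+_ (k ℤ.* F (δ ++ γ))) (⟪·h⟫ x γ F)

⟪⟫-cong : ∀ x {F G : Series} → (∀ δ → F δ ≡ G δ) → ⟪ x , F ⟫ ≡ ⟪ x , G ⟫
⟪⟫-cong []            F≗G = refl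
⟪⟫-cong ((k , δ) ∷ x) F≗G = cong₂ (λ a b → k ℤ.* a ℤ.+ b) (F≗G δ) (⟪⟫-cong x F≗G)

⟪⟫-sumℤ : ∀ x (L : List (List ℕ)) (F : List ℕ → Series) (c : List ℕ → ℤ) →
  ⟪ x , (λ δ → sumℤ (map (λ σ → F σ δ ℤ.* c σ) L)) ⟫ ≡ sumℤ (map (λ σ → ⟪ x , F σ ⟫ ℤ.* c σ) L)
⟪⟫-sumℤ []            L F c = sym (sumℤ-zero L (All.tabulate λ {σ} _ → ℤₚ.*-zeroˡ (c σ)))
⟪⟫-sumℤ ((k , δ) ∷ x) L F c = begin
  k ℤ.* sumℤ (map (λ σ → F σ δ ℤ.* c σ) L) ℤ.+ ⟪ x , _ ⟫
    ≡⟨ cong₂ ℤ._+_ (sumℤ-*ˡ k (λ σ → F σ δ ℤ.* c σ) L) (⟪⟫-sumℤ x L F c) ⟩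
  sumℤ (map (λ σ → k ℤ.* (F σ δ ℤ.* c σ)) L) ℤ.+ sumℤ (map (λ σ → ⟪ x , F σ ⟫ ℤ.* c σ) L)
    ≡⟨ sumℤ-+ (λ σ → k ℤ.* (F σ δ ℤ.* c σ)) (λ σ → ⟪ x , F σ ⟫ ℤ.* c σ) L ⟩
  sumℤ (map (λ σ → k ℤ.* (F σ δ ℤ.* c σ) ℤ.+ ⟪ x , F σ ⟫ ℤ.* c σ) L)
    ≡⟨ sumℤ-cong-local L (All.tabulate λ {σ} _ → factor (F σ δ) ⟪ x , F σ ⟫ (c σ)) ⟩
  sumℤ (map (λ σ → (k ℤ.* F σ δ ℤ.+ ⟪ x , F σ ⟫) ℤ.* c σ) L)
    ∎
  where
  open ≡-Reasoning
  factor : ∀ a b d → k ℤ.* (a ℤ.* d) ℤ.+ b ℤ.* d ≡ (k ℤ.* a ℤ.+ b) ℤ.* d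
  factor a b d = trans (cong (λ e → e ℤ.+ b ℤ.* d) (sym (ℤₚ.*-assoc k a d))) (sym (ℤₚ.*-distribʳ-+ d (k ℤ.* a) b))

-- Counting tableaux

module Counting {Rr Rc : ℕ → ℕ → Set} (row : ShiftStable Rr) (col : ShiftStable Rc) where

  Valid : List ℕ → List ℕ → Filling → Set
  Valid α β T = All (Linked Rr) T × Linked Rc (firstCol (skewRows α β) T)

  valid? : ∀ α β T → Dec (Valid α β T)
  valid? α β T = All.all? (Linked.linked? (ShiftStable.dec row)) T ×-dec Linked.linked? (ShiftStable.dec col) (firstCol (skewRows α β) T)

  tableau? : ∀ m α β c T → Dec (Valid α β T × content m T ≡ c)
  tableau? m α β c T = valid? α β T ×-dec ≡-dec _≟_ (content m T) c

  #tableaux : ℕ → List ℕ → List ℕ → List ℕ → ℕ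
  #tableaux m α β c = length (filter (tableau? m α β c) (fillings m (rowLengths α β)))

  Triple : Set
  Triple = List ℕ × Filling × Filling

  triples : ℕ → ℕ → List ℕ → List ℕ → List Triple
  triples m₁ m₂ α β = concatMap (λ σ → map (σ ,_) (cartesianProduct (fillings m₁ (rowLengths σ β)) (fillings m₂ (rowLengths α σ))))
                                (between β α)

  IsTriple : ℕ → ℕ → List ℕ → List ℕ → List ℕ → List ℕ → Triple → Set
  IsTriple m₁ m₂ α β δ γ (σ , T₁ , T₂) = (Valid σ β T₁ × content m₁ T₁ ≡ δ) × (Valid α σ T₂ × content m₂ T₂ ≡ γ)

  triple? : ∀ m₁ m₂ α β δ γ t → Dec (IsTriple m₁ m₂ α β δ γ t)
  triple? m₁ m₂ α β δ γ (σ , T₁ , T₂) = tableau? m₁ σ β δ T₁ ×-dec tableau? m₂ α σ γ T₂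

  triples-unique : ∀ m₁ m₂ α β → Unique (triples m₁ m₂ α β)
  triples-unique m₁ m₂ α β = unique-concatMap _ proj₁ (between-unique β α)
    (λ {σ} _ → Uniqueₚ.map⁺ (cong proj₂)
                 (Uniqueₚ.cartesianProduct⁺ (fillings-unique m₁ (rowLengths σ β)) (fillings-unique m₂ (rowLengths α σ))))
    (λ {σ} _ t∈ → let _ , _ , t≡ = ∈-map⁻ (σ ,_) t∈ in cong proj₁ t≡)

  length-filter-triples : ∀ m₁ m₂ α β δ γ →
    length (filter (triple? m₁ m₂ α β δ γ) (triples m₁ m₂ α β)) ≡ ∑ (λ σ → #tableaux m₁ σ β δ * #tableaux m₂ α σ γ) (between β α)
  length-filter-triples m₁ m₂ α β δ γ = begin
    length (filter (triple? m₁ m₂ α β δ γ) (triples m₁ m₂ α β))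
      ≡⟨ length-filter≡∑𝟙 (triple? m₁ m₂ α β δ γ) (triples m₁ m₂ α β) ⟩
    ∑ (𝟙 ∘ triple? m₁ m₂ α β δ γ) (triples m₁ m₂ α β)
      ≡⟨ ∑-concatMap (𝟙 ∘ triple? m₁ m₂ α β δ γ) _ (between β α) ⟩
    ∑ (λ σ → ∑ (𝟙 ∘ triple? m₁ m₂ α β δ γ) (map (σ ,_) (F₁ σ ⊗ F₂ σ))) (between β α)
      ≡⟨ ∑-cong-local (between β α) (All.tabulate λ {σ} _ → fibre σ) ⟩
    ∑ (λ σ → #tableaux m₁ σ β δ * #tableaux m₂ α σ γ) (between β α)
      ∎
    where
    open ≡-Reasoning
    F₁ F₂ : List ℕ → List Filling
    F₁ σ = fillings m₁ (rowLengths σ β)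
    F₂ σ = fillings m₂ (rowLengths α σ)
    _⊗_ : List Filling → List Filling → List (Filling × Filling)
    _⊗_ = cartesianProduct
    fibre : ∀ σ → ∑ (𝟙 ∘ triple? m₁ m₂ α β δ γ) (map (σ ,_) (F₁ σ ⊗ F₂ σ)) ≡ #tableaux m₁ σ β δ * #tableaux m₂ α σ γ
    fibre σ = begin
      ∑ (𝟙 ∘ triple? m₁ m₂ α β δ γ) (map (σ ,_) (F₁ σ ⊗ F₂ σ))
        ≡⟨ ∑-map (𝟙 ∘ triple? m₁ m₂ α β δ γ) (σ ,_) (F₁ σ ⊗ F₂ σ) ⟩
      ∑ (λ p → 𝟙 (tableau? m₁ σ β δ (proj₁ p) ×-dec tableau? m₂ α σ γ (proj₂ p))) (F₁ σ ⊗ F₂ σ)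
        ≡⟨ ∑-cong-local (F₁ σ ⊗ F₂ σ)
             (All.tabulate λ {p} _ → 𝟙-×-dec (tableau? m₁ σ β δ (proj₁ p)) (tableau? m₂ α σ γ (proj₂ p))) ⟩
      ∑ (λ p → 𝟙 (tableau? m₁ σ β δ (proj₁ p)) * 𝟙 (tableau? m₂ α σ γ (proj₂ p))) (F₁ σ ⊗ F₂ σ)
        ≡⟨ ∑-cartesianProduct (𝟙 ∘ tableau? m₁ σ β δ) (𝟙 ∘ tableau? m₂ α σ γ) (F₁ σ) (F₂ σ) ⟩
      ∑ (𝟙 ∘ tableau? m₁ σ β δ) (F₁ σ) * ∑ (𝟙 ∘ tableau? m₂ α σ γ) (F₂ σ)
        ≡⟨ cong₂ _*_ (length-filter≡∑𝟙 (tableau? m₁ σ β δ) (F₁ σ)) (length-filter≡∑𝟙 (tableau? m₂ α σ γ) (F₂ σ)) ⟨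
      #tableaux m₁ σ β δ * #tableaux m₂ α σ γ
        ∎

  module _ {α β : List ℕ} (δ γ : List ℕ) (α>0 : IsComp α) (β>0 : IsComp β) (β⊆α : β ⊆c α) where
    private
      m₁ m₂ : ℕ
      m₁ = length δ
      m₂ = length γ

    splitTableau : Filling → Triple
    splitTableau T = proj₁ (lowerPart m₁ β T) , proj₂ (lowerPart m₁ β T) , upperPart m₁ T

    joinTriple : Triple → Filling
    joinTriple (_ , T₁ , T₂) = joinTableau m₁ T₁ T₂

    split-contents : ∀ T₁ T₂ → content m₁ T₁ ++ content m₂ T₂ ≡ δ ++ γ → content m₁ T₁ ≡ δ × content m₂ T₂ ≡ γ
    split-contents T₁ T₂ = ++-injective (content m₁ T₁) (length-content m₁ T₁)

    splitTableau-ok : ∀ {T} → T ∈ fillings (m₁ + m₂) (rowLengths α β) → Valid α β T × content (m₁ + m₂) T ≡ δ ++ γ →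
      (splitTableau T ∈ triples m₁ m₂ α β × IsTriple m₁ m₂ α β δ γ (splitTableau T)) × joinTriple (splitTableau T) ≡ T
    splitTableau-ok {T} T∈ ((rows , lc) , T-content) =
      subst (λ t → (t ∈ triples m₁ m₂ α β × IsTriple m₁ m₂ α β δ γ t) × joinTriple t ≡ T) (sym splitTableau≡)
            ((member , ((lower-rows , lower-lc) , proj₁ contents) , ((upper-rows , upper-lc) , proj₂ contents)) , rejoin)
      where
      fill : Fill (m₁ + m₂) T (rowLengths α β)
      fill = ∈-fillings⁻ (rowLengths α β) T∈
      open Split (split row col m₁ m₂ α β α>0 β>0 β⊆α fill rows lc)
      splitTableau≡ : splitTableau T ≡ (shape , lower , upperPart m₁ T)
      splitTableau≡ = cong (λ p → proj₁ p , proj₂ p , upperPart m₁ T) lowerPart≡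
      member : (shape , lower , upperPart m₁ T) ∈ triples m₁ m₂ α β
      member = ∈-concatMap⁺ _ (lose (∈-between⁺ β⊆shape shape⊆α shape-comp)
                                    (∈-map⁺ (shape ,_) (∈-cartesianProduct⁺ (∈-fillings⁺ lower-fill) (∈-fillings⁺ upper-fill))))
      lower-lc : Linked Rc (firstCol (skewRows shape β) lower)
      lower-lc = subst (Linked Rc) (sym lower-col) (lowerRow-linked col m₁ lc)
      upper-rows : All (Linked Rr) (upperPart m₁ T)
      upper-rows = Allₚ.map⁺ (All.map (upperRow-linked row m₁) rows)
      upper-lc : Linked Rc (firstCol (skewRows α shape) (upperPart m₁ T))
      upper-lc = subst (Linked Rc) (sym upper-col) (upperRow-linked col m₁ lc)
      lengths : length lower ≤ length (upperPart m₁ T)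
      lengths = subst₂ _≤_ (sym (length-Fill shape β lower-fill)) (sym (length-Fill α shape upper-fill)) (⊆c-length shape⊆α)
      contents : content m₁ lower ≡ δ × content m₂ (upperPart m₁ T) ≡ γ
      contents = split-contents lower (upperPart m₁ T)
        (trans (sym (content-joinTableau m₁ m₂ lengths (Fill⇒All lower-fill) (Fill⇒All upper-fill)))
               (trans (cong (content (m₁ + m₂)) rejoin) T-content))

    joinTriple-ok : ∀ {t} → t ∈ triples m₁ m₂ α β → IsTriple m₁ m₂ α β δ γ t →
      (joinTriple t ∈ fillings (m₁ + m₂) (rowLengths α β) × Valid α β (joinTriple t) × content (m₁ + m₂) (joinTriple t) ≡ δ ++ γ) ×
      splitTableau (joinTriple t) ≡ t
    joinTriple-ok {σ , T₁ , T₂} t∈ (((rows₁ , lc₁) , content₁) , ((rows₂ , lc₂) , content₂))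
      with σ′ , σ′∈ , t∈σ′ ← find (∈-concatMap⁻ _ {xs = between β α} t∈)
      with _ , p∈ , refl ← ∈-map⁻ (σ′ ,_) t∈σ′ =
      (∈-fillings⁺ join-fill , (join-rows , join-lc) , join-content) ,
      cong₂ (λ p T → proj₁ p , proj₂ p , T) lowerPart-join upperPart-join
      where
      σ-between : β ⊆c σ × σ ⊆c α × IsComp σ
      σ-between = ∈-between⁻ α σ′∈
      σ⊆α : σ ⊆c α
      σ⊆α = proj₁ (proj₂ σ-between)
      T-fillings : T₁ ∈ fillings m₁ (rowLengths σ β) × T₂ ∈ fillings m₂ (rowLengths α σ)
      T-fillings = ∈-cartesianProduct⁻ (fillings m₁ (rowLengths σ β)) (fillings m₂ (rowLengths α σ)) p∈
      fill₁ : Fill m₁ T₁ (rowLengths σ β)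
      fill₁ = ∈-fillings⁻ (rowLengths σ β) (proj₁ T-fillings)
      fill₂ : Fill m₂ T₂ (rowLengths α σ)
      fill₂ = ∈-fillings⁻ (rowLengths α σ) (proj₂ T-fillings)
      open Join (join row col m₁ m₂ α β σ β>0 (proj₂ (proj₂ σ-between)) (proj₁ σ-between) σ⊆α fill₁ fill₂ rows₁ rows₂)
      join-lc : Linked Rc (firstCol (skewRows α β) (joinTableau m₁ T₁ T₂))
      join-lc = subst (Linked Rc) (sym join-col)
        (joinRow-linked col m₁ lc₁ lc₂ (All.map proj₂ (firstCol-All (skewRows σ β) (Fill⇒All fill₁)))
                                       (All.map proj₁ (firstCol-All (skewRows α σ) (Fill⇒All fill₂))))
      lengths : length T₁ ≤ length T₂
      lengths = subst₂ _≤_ (sym (length-Fill σ β fill₁)) (sym (length-Fill α σ fill₂)) (⊆c-length σ⊆α)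
      join-content : content (m₁ + m₂) (joinTableau m₁ T₁ T₂) ≡ δ ++ γ
      join-content = trans (content-joinTableau m₁ m₂ lengths (Fill⇒All fill₁) (Fill⇒All fill₂)) (cong₂ _++_ content₁ content₂)

    #tableaux-++ : #tableaux (length δ + length γ) α β (δ ++ γ)
                   ≡ ∑ (λ σ → #tableaux (length δ) σ β δ * #tableaux (length γ) α σ γ) (between β α)
    #tableaux-++ =
      trans (length-filter-bijection (tableau? (m₁ + m₂) α β (δ ++ γ)) (triple? m₁ m₂ α β δ γ)
                                     (fillings-unique (m₁ + m₂) (rowLengths α β)) (triples-unique m₁ m₂ α β)
                                     splitTableau joinTriple splitTableau-ok joinTriple-ok)
            (length-filter-triples m₁ m₂ α β δ γ)

  #tableaux-size : ∀ m α β c → sum c ≢ sum (rowLengths α β) → #tableaux m α β c ≡ 0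
  #tableaux-size m α β c c≢ = cong length (Listₚ.filter-none (tableau? m α β c) (All.tabulate λ T∈ (_ , c≡) → c≢ (sizes T∈ c≡)))
    where
    sizes : ∀ {T} → T ∈ fillings m (rowLengths α β) → content m T ≡ c → sum c ≡ sum (rowLengths α β)
    sizes {T} T∈ c≡ = let fill = ∈-fillings⁻ (rowLengths α β) T∈ in
      trans (cong sum (sym c≡)) (trans (sum-content m T (Fill⇒All fill)) (length-concat-Fill fill))

  #tableaux-empty : ∀ β → #tableaux 1 β β [ 0 ] ≡ 1
  #tableaux-empty β =
    trans (cong (length ∘ filter (tableau? 1 β β [ 0 ])) (trans (cong (fillings 1) (rowLengths-self β)) (fillings-zeros 1 β)))
          (cong length (Listₚ.filter-accept (tableau? 1 β β [ 0 ]) ((empty-rows β , empty-col) , empty-content β)))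
    where
    empty-rows : ∀ β → All (Linked Rr) (emptyFilling β)
    empty-rows []      = []
    empty-rows (_ ∷ β) = [] ∷ empty-rows β
    empty-col : Linked Rc (firstCol (skewRows β β) (emptyFilling β))
    empty-col = subst (Linked Rc) (sym (firstCol-emptyFilling (skewRows β β) β)) []
    empty-content : ∀ β → content 1 (emptyFilling β) ≡ [ 0 ]
    empty-content []      = refl
    empty-content (_ ∷ β) = empty-content β

  coeff : List ℕ → List ℕ → List ℕ → ℕ
  coeff α β c = #tableaux (length c) α β c

  coeff-++ : ∀ α β δ γ → IsComp α → IsComp β → β ⊆c α →
    coeff α β (δ ++ γ) ≡ ∑ (λ σ → coeff σ β δ * coeff α σ γ) (between β α)
  coeff-++ α β δ γ α>0 β>0 β⊆α =
    trans (cong (λ m → #tableaux m α β (δ ++ γ)) (Listₚ.length-++ δ)) (#tableaux-++ δ γ α>0 β>0 β⊆α)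

  coeff-size : ∀ α β c → β ⊆c α → sum c ≢ size α ∸ size β → coeff α β c ≡ 0
  coeff-size α β c β⊆α c≢ = #tableaux-size (length c) α β c (λ c≡ → c≢ (trans c≡ (sum-rowLengths β⊆α)))

  ∑-coeff-[0] : ∀ α σ (h : List ℕ → ℕ) → IsComp σ → σ ⊆c α → ∑ (λ τ → coeff τ σ [ 0 ] * h τ) (between σ α) ≡ h σ
  ∑-coeff-[0] α σ h σ>0 σ⊆α =
    ∑-delta (between σ α) (λ τ → coeff τ σ [ 0 ]) h (between-unique σ α) (∈-between⁺ (⊆c-refl σ) σ⊆α σ>0)
            coeff≡0 (#tableaux-empty σ)
    where
    coeff≡0 : ∀ {τ} → τ ∈ between σ α → τ ≢ σ → coeff τ σ [ 0 ] ≡ 0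
    coeff≡0 {τ} τ∈ τ≢σ with σ⊆τ , _ , τ>0 ← ∈-between⁻ α τ∈ =
      #tableaux-size 1 τ σ [ 0 ] (λ 0≡ → τ≢σ (sum-rowLengths≡0 σ⊆τ τ>0 (sym 0≡)))

  -- Splitting off the exponent 0 leaves only the empty skew shape σ/σ.
  coeff-drop0 : ∀ α β u v → IsComp α → IsComp β → β ⊆c α → coeff α β (u ++ 0 ∷ v) ≡ coeff α β (u ++ v)
  coeff-drop0 α β u v α>0 β>0 β⊆α = begin
    coeff α β (u ++ 0 ∷ v)
      ≡⟨ coeff-++ α β u (0 ∷ v) α>0 β>0 β⊆α ⟩
    ∑ (λ σ → coeff σ β u * coeff α σ (0 ∷ v)) (between β α)
      ≡⟨ ∑-cong-local (between β α) (All.tabulate λ {σ} σ∈ → cong (coeff σ β u *_) (drop-row σ∈)) ⟩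
    ∑ (λ σ → coeff σ β u * coeff α σ v) (between β α)
      ≡⟨ coeff-++ α β u v α>0 β>0 β⊆α ⟨
    coeff α β (u ++ v)
      ∎
    where
    open ≡-Reasoning
    drop-row : ∀ {σ} → σ ∈ between β α → coeff α σ (0 ∷ v) ≡ coeff α σ v
    drop-row {σ} σ∈ with _ , σ⊆α , σ>0 ← ∈-between⁻ α σ∈ =
      trans (coeff-++ α σ [ 0 ] v α>0 σ>0 σ⊆α) (∑-coeff-[0] α σ (λ τ → coeff α τ v) σ>0 σ⊆α)

  coeff-flat : ∀ α β → IsComp α → IsComp β → β ⊆c α → ∀ c → coeff α β c ≡ coeff α β (flat c)
  coeff-flat α β α>0 β>0 β⊆α c = after [] c
    where
    after : ∀ u c → coeff α β (u ++ c) ≡ coeff α β (u ++ flat c)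
    after u []          = refl
    after u (zero ∷ c)  = trans (coeff-drop0 α β u c α>0 β>0 β⊆α) (after u c)
    after u (suc a ∷ c) = begin
      coeff α β (u ++ suc a ∷ c)            ≡⟨ cong (coeff α β) (Listₚ.++-assoc u [ suc a ] c) ⟨
      coeff α β ((u ++ [ suc a ]) ++ c)      ≡⟨ after (u ++ [ suc a ]) c ⟩
      coeff α β ((u ++ [ suc a ]) ++ flat c) ≡⟨ cong (coeff α β) (Listₚ.++-assoc u [ suc a ] (flat c)) ⟩
      coeff α β (u ++ suc a ∷ flat c)        ∎
      where open ≡-Reasoning

  series : List ℕ → Series
  series α c = ℤ.+ coeff α [] c

  module _ (S : List ℕ → NSym) (dual : ∀ α β → IsComp α → IsComp β → ⟪ S β , series α ⟫ ≡ kron α β)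
           {α β : List ℕ} (α>0 : IsComp α) (β>0 : IsComp β) (β⊆α : β ⊆c α) where

    ⟪S·h,series⟫ : ∀ γ → ⟪ S β ·h γ , series α ⟫ ≡ ℤ.+ coeff α β γ
    ⟪S·h,series⟫ γ = begin
      ⟪ S β ·h γ , series α ⟫
        ≡⟨ ⟪·h⟫ (S β) γ (series α) ⟩
      ⟪ S β , (λ δ → series α (δ ++ γ)) ⟫
        ≡⟨ ⟪⟫-cong (S β) series-++ ⟩
      ⟪ S β , (λ δ → sumℤ (map (λ σ → series σ δ ℤ.* ℤ.+ coeff α σ γ) (between [] α))) ⟫
        ≡⟨ ⟪⟫-sumℤ (S β) (between [] α) series (λ σ → ℤ.+ coeff α σ γ) ⟩
      sumℤ (map (λ σ → ⟪ S β , series σ ⟫ ℤ.* ℤ.+ coeff α σ γ) (between [] α))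
        ≡⟨ sumℤ-cong-local (between [] α) (All.tabulate λ {σ} σ∈ → by-duality σ (proj₂ (proj₂ (∈-between⁻ α σ∈)))) ⟩
      sumℤ (map (λ σ → ℤ.+ coeff α σ γ ℤ.* kron σ β) (between [] α))
        ≡⟨ sumℤ-kron (between [] α) (λ σ → ℤ.+ coeff α σ γ) (between-unique [] α) (∈-between⁺ []⊆ β⊆α β>0) ⟩
      ℤ.+ coeff α β γ
        ∎
      where
      open ≡-Reasoning
      series-++ : ∀ δ → series α (δ ++ γ) ≡ sumℤ (map (λ σ → series σ δ ℤ.* ℤ.+ coeff α σ γ) (between [] α))
      series-++ δ = trans (cong ℤ.+_ (coeff-++ α [] δ γ α>0 [] []⊆))
        (trans (+-∑ (λ σ → coeff σ [] δ * coeff α σ γ) (between [] α))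
               (sumℤ-cong-local (between [] α) (All.tabulate λ {σ} _ → ℤₚ.pos-* (coeff σ [] δ) (coeff α σ γ))))
      by-duality : ∀ σ → IsComp σ → ⟪ S β , series σ ⟫ ℤ.* ℤ.+ coeff α σ γ ≡ ℤ.+ coeff α σ γ ℤ.* kron σ β
      by-duality σ σ>0 = trans (cong (ℤ._* ℤ.+ coeff α σ γ) (dual σ β σ>0 β>0)) (ℤₚ.*-comm (kron σ β) _)

    skewDual≡coeff : ∀ c → skewDual S series α β c ≡ ℤ.+ coeff α β c
    skewDual≡coeff c = trans (sumℤ-cong-local (comps n) (All.tabulate λ {γ} _ → cong (ℤ._* M γ c) (⟪S·h,series⟫ γ))) by-size
      where
      n : ℕ
      n = size α ∸ size β
      by-size : sumℤ (map (λ γ → ℤ.+ coeff α β γ ℤ.* kron γ (flat c)) (comps n)) ≡ ℤ.+ coeff α β c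
      by-size with sum c ≟ n
      ... | yes c≡n = trans (sumℤ-kron (comps n) (λ γ → ℤ.+ coeff α β γ) (comps-unique n) flat∈)
                            (cong ℤ.+_ (sym (coeff-flat α β α>0 β>0 β⊆α c)))
        where
        flat∈ : flat c ∈ comps n
        flat∈ = ∈-comps⁺ n (flat-comp c) (trans (sum-flat c) c≡n)
      ... | no  c≢n = trans (sumℤ-kron-∉ (comps n) (λ γ → ℤ.+ coeff α β γ) flat∉)
                            (cong ℤ.+_ (sym (coeff-size α β c β⊆α c≢n)))
        where
        flat∉ : flat c ∉ comps n
        flat∉ flat∈ = c≢n (trans (sym (sum-flat c)) (proj₂ (∈-comps⁻ n flat∈)))

-- For these relations `tableau?` unfolds to the predicates filtered in `skewImmSeries` and
-- `skewRowStrictSeries`, so `series` and `ℤ.+ coeff α β` are the series of the theorem definitionally.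
module Immaculate = Counting ≤-shiftStable <-shiftStable
module RowStrict  = Counting <-shiftStable ≤-shiftStable

theorem4p8 : (S RS : List ℕ → NSym) → IsDualBasis S dualImm → IsDualBasis RS rowStrictDualImm →
    (α β : List ℕ) → IsComp α → IsComp β → β ⊆c α →
    ((c : List ℕ) → skewDual S dualImm α β c ≡ skewImmSeries α β c) ×
    ((c : List ℕ) → skewDual RS rowStrictDualImm α β c ≡ skewRowStrictSeries α β c)
theorem4p8 S RS (_ , S-dual) (_ , RS-dual) α β α>0 β>0 β⊆α =
  Immaculate.skewDual≡coeff S S-dual α>0 β>0 β⊆α , RowStrict.skewDual≡coeff RS RS-dual α>0 β>0 β⊆α
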